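{- For all integers $n\geq 0$, \[ T_2(n)\equiv\begin{cases}1\pmod 2, & \text{if } n=m(m+1)/2 \text{ for some integer } m,\\ 0\pmod 2, & \text{otherwise}.\end{cases} \]
   Context: A partition of a non-negative integer $n$ is $\ell$-regular if none of its parts is divisible by $\ell$ (the empty partition of $0$ counts). A $k$-tuple $\ell$-regular partition of $n$ is a sequence $(\lambda_1,\dots,\lambda_k)$ where $\lambda_i$ is an $\ell$-regular partition of $n_i\ge 0$ and $n_1+\cdots+n_k=n$. $T_{\ell,k}(n)$ denotes the number of $k$-tuple $\ell$-regular partitions of $n$, and $T_\ell(n):=T_{\ell,3}(n)$; thus $\sum_{n\ge0}T_2(n)q^n=\prod_{i\ge1}\frac{(1-q^{2i})^3}{(1-q^i)^3}$. -}

module Defs where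

open import Data.Nat using (ℕ; zero; suc; _+_; _*_; _≥_; _≤_)
open import Data.Nat.Divisibility using (_∣_)
open import Data.Nat.ListAction using (sum)
open import Data.List using (List; length)
open import Data.List.Relation.Unary.All using (All)
open import Data.List.Relation.Unary.Linked using (Linked)
open import Data.List.Relation.Unary.Unique.Propositional using (Unique)
open import Data.List.Membership.Propositional using (_∈_)
open import Data.Vec using (Vec; foldr)
open import Data.Product using (Σ; _×_; ∃)
open import Relation.Nullary using (¬_)
open import Relation.Binary.PropositionalEquality using (_≡_)
open import Function.Bundles using (_⇔_)

record IsPartition (n : ℕ) (λs : List ℕ) : Set where
  field
    decreasing : Linked _≥_ λs
    positive   : All (λ p → 1 ≤ p) λs
    sums       : sum λs ≡ n

IsRegular : ℕ → List ℕ → Set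
IsRegular ℓ λs = All (λ p → ¬ (ℓ ∣ p)) λs

IsRegularPartition : ℕ → ℕ → List ℕ → Set
IsRegularPartition ℓ n λs = IsPartition n λs × IsRegular ℓ λs

IsTupleRegPartition : (ℓ k n : ℕ) → Vec (List ℕ) k → Set
IsTupleRegPartition ℓ k n t =
  Σ (Vec ℕ k) λ ns →
    Data.Vec.foldr _ _+_ 0 ns ≡ n ×
    (∀ i → IsRegularPartition ℓ (Data.Vec.lookup ns i) (Data.Vec.lookup t i))

-- L is a duplicate-free listing of exactly the k-tuple ℓ-regular partitions
-- of n; hence T_{ℓ,k}(n) = length L.
Enumerates : (ℓ k n : ℕ) → List (Vec (List ℕ) k) → Set
Enumerates ℓ k n L = Unique L × (∀ t → (t ∈ L) ⇔ IsTupleRegPartition ℓ k n t)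

Triangular : ℕ → Set
Triangular n = ∃ λ m → 2 * n ≡ m * suc m

-- A 2-regular partition is a partition into odd parts, so modulo 2 the generating function of T₂
-- is E³, where E ⊗ O = 1 for O = ∏ (1 + q^(2m+1)). The claim is thus θ ⊗ O⁴ ≡ O for the theta
-- series θ = ∑ q^(m(m+1)/2). Write O = ∏ (1 + q^(4m+3)) (1 + q^(4m+1)) and expand both products
-- by elementary symmetric functions. Group the terms by the charge k, the number of factors taken
-- from the first product minus the number taken from the second. The charge-k part is then
-- q^(m(m+1)/2) times the charge-zero part, where m = 2k for k ≥ 0 and m = −2k − 1 for k < 0:
-- this is the functional equation behind Jacobi's triple product. By the Frobenius endomorphism
-- the charge-zero part ∑ⱼ eⱼ(q³, q⁷, …) eⱼ(q, q⁵, …) equals (∑ⱼ eⱼ(q, q³, q⁵, …))⁴ = O⁴.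
-- Infinite products are replaced by finite ones, which agree with them up to any given degree.

module Submission where

open import Defs
open import Data.Nat using (ℕ; _%_)
open import Data.List using (List; length)
open import Data.Vec using (Vec)
open import Data.Product using (Σ; _×_)
open import Relation.Nullary using (¬_)
open import Relation.Binary.PropositionalEquality using (_≡_)

open import Algebra.Bundles using (CommutativeRing)
open import Relation.Binary.Bundles using (Setoid)
import Algebra.Construct.Pointwise as Pointwise
import Algebra.Solver.Ring.AlmostCommutativeRing as ACR
open import Data.Empty using (⊥-elim)
open import Data.Fin using (zero; suc)
open import Data.List using ([]; _∷_; _++_; map; cartesianProduct)
open import Data.List.Properties using (length-map; length-++; ++-identityʳ; ∷-injectiveʳ)
open import Data.List.Membership.Propositional using (_∈_)
open import Data.List.Membership.Propositional.Properties
  using (∈-map⁺; ∈-map⁻; ∈-++⁺ˡ; ∈-++⁺ʳ; ∈-++⁻; ∈-cartesianProduct⁺; ∈-cartesianProduct⁻)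
open import Data.List.Relation.Unary.All as All using (All; []; _∷_)
open import Data.List.Relation.Unary.AllPairs using ([]; _∷_)
open import Data.List.Relation.Unary.Any using (here)
open import Data.List.Relation.Unary.Linked as Linked using (Linked; []; [-]; _∷_)
open import Data.List.Relation.Unary.Unique.Propositional using (Unique)
import Data.List.Relation.Unary.Unique.Propositional.Properties as Uniqueₚ
open import Data.Maybe using (Maybe; just; nothing)
open import Data.Nat using (zero; suc; _+_; _*_; _∸_; _≤_; _<_; _≥_; z≤n; s≤s; _≤′_; ≤′-refl; ≤′-step; _≤?_; _<?_; parity)
open import Data.Nat.Divisibility using (_∣_; divides)
open import Data.Nat.ListAction using (sum)
import Data.Nat.Properties as ℕₚ
open import Data.Nat.Tactic.RingSolver using (solve-∀)
open import Data.Parity.Base as ℙ using (Parity; 0ℙ; 1ℙ)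
import Data.Parity.Properties as ℙₚ
open import Algebra.Properties.CommutativeSemigroup ℙₚ.+-commutativeSemigroup using (interchange; x∙yz≈y∙xz)
open import Data.Product using (_,_; proj₁; proj₂; ∃)
open import Data.Sum using (inj₁; inj₂)
import Data.Vec as Vec
open import Data.Vec using ([]; _∷_)
open import Function using (_∘_; case_of_)
open import Function.Bundles using (mk⇔)
open import Level using (0ℓ)
open import Relation.Binary.PropositionalEquality using (_≢_; refl; sym; trans; cong; cong₂; subst; module ≡-Reasoning)
import Relation.Binary.Reasoning.Setoid as SetoidReasoning
open import Relation.Nullary using (Dec; yes; no)

-- Formal power series over ℤ/2

Series : Set
Series = ℕ → Parity

infix 4 _≈_
_≈_ : Series → Series → Set
f ≈ g = ∀ n → f n ≡ g n

0ₛ 1ₛ : Series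
0ₛ _ = 0ℙ
1ₛ zero = 1ℙ
1ₛ (suc _) = 0ℙ

infix 9 q^_
q^_ : ℕ → Series
q^ zero = 1ₛ
(q^ suc k) zero = 0ℙ
(q^ suc k) (suc n) = (q^ k) n

infixl 6 _⊕_
infixl 7 _⊗_ _·_

_⊕_ : Series → Series → Series
(f ⊕ g) n = f n ℙ.+ g n

_·_ : Parity → Series → Series
(c · g) n = c ℙ.* g n

tail : Series → Series
tail f n = f (suc n)

-- The Cauchy product, by recursion on the degree: f = f₀ + q · tail f.
_⊗_ : Series → Series → Series
(f ⊗ g) zero = f 0 ℙ.* g 0
(f ⊗ g) (suc n) = f 0 ℙ.* g (suc n) ℙ.+ (tail f ⊗ g) n

⊗-congʳ : ∀ {f f′} g → f ≈ f′ → f ⊗ g ≈ f′ ⊗ g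
⊗-congʳ g f≈f′ zero = cong (ℙ._* g 0) (f≈f′ 0)
⊗-congʳ g f≈f′ (suc n) =
  cong₂ ℙ._+_ (cong (ℙ._* g (suc n)) (f≈f′ 0)) (⊗-congʳ g (λ k → f≈f′ (suc k)) n)

⊗-congˡ : ∀ f {g g′} → g ≈ g′ → f ⊗ g ≈ f ⊗ g′
⊗-congˡ f g≈g′ zero = cong (f 0 ℙ.*_) (g≈g′ 0)
⊗-congˡ f g≈g′ (suc n) = cong₂ ℙ._+_ (cong (f 0 ℙ.*_) (g≈g′ (suc n))) (⊗-congˡ (tail f) g≈g′ n)

⊗-cong : ∀ {f f′ g g′} → f ≈ f′ → g ≈ g′ → f ⊗ g ≈ f′ ⊗ g′
⊗-cong {f′ = f′} {g = g} f≈f′ g≈g′ n = trans (⊗-congʳ g f≈f′ n) (⊗-congˡ f′ g≈g′ n)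

⊗-zeroˡ : ∀ g → 0ₛ ⊗ g ≈ 0ₛ
⊗-zeroˡ g zero = refl
⊗-zeroˡ g (suc n) = ⊗-zeroˡ g n

⊗-identityˡ : ∀ g → 1ₛ ⊗ g ≈ g
⊗-identityˡ g zero = ℙₚ.*-identityˡ (g 0)
⊗-identityˡ g (suc n) = trans (cong (g (suc n) ℙ.+_) (⊗-zeroˡ g n)) (ℙₚ.+-identityʳ _)

⊗-distribʳ : ∀ h f g → (f ⊕ g) ⊗ h ≈ f ⊗ h ⊕ g ⊗ h
⊗-distribʳ h f g zero = ℙₚ.*-distribʳ-+ (h 0) (f 0) (g 0)
⊗-distribʳ h f g (suc n) =
  trans (cong₂ ℙ._+_ (ℙₚ.*-distribʳ-+ (h (suc n)) (f 0) (g 0)) (⊗-distribʳ h (tail f) (tail g) n))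
        (interchange (f 0 ℙ.* h (suc n)) (g 0 ℙ.* h (suc n)) ((tail f ⊗ h) n) ((tail g ⊗ h) n))

⊗-distribˡ : ∀ f g h → f ⊗ (g ⊕ h) ≈ f ⊗ g ⊕ f ⊗ h
⊗-distribˡ f g h zero = ℙₚ.*-distribˡ-+ (f 0) (g 0) (h 0)
⊗-distribˡ f g h (suc n) =
  trans (cong₂ ℙ._+_ (ℙₚ.*-distribˡ-+ (f 0) (g (suc n)) (h (suc n))) (⊗-distribˡ (tail f) g h n))
        (interchange (f 0 ℙ.* g (suc n)) (f 0 ℙ.* h (suc n)) ((tail f ⊗ g) n) ((tail f ⊗ h) n))

·-⊗-assoc : ∀ c g h → (c · g) ⊗ h ≈ c · (g ⊗ h)
·-⊗-assoc c g h zero = ℙₚ.*-assoc c (g 0) (h 0)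
·-⊗-assoc c g h (suc n) =
  trans (cong₂ ℙ._+_ (ℙₚ.*-assoc c (g 0) (h (suc n))) (·-⊗-assoc c (tail g) h n))
        (sym (ℙₚ.*-distribˡ-+ c (g 0 ℙ.* h (suc n)) ((tail g ⊗ h) n)))

-- tail (f ⊗ g) is f₀ · tail g ⊕ tail f ⊗ g by definition.
⊗-assoc : ∀ f g h → (f ⊗ g) ⊗ h ≈ f ⊗ (g ⊗ h)
⊗-assoc f g h zero = ℙₚ.*-assoc (f 0) (g 0) (h 0)
⊗-assoc f g h (suc n) = begin
  ((f 0 ℙ.* g 0) ℙ.* h (suc n)) ℙ.+ ((f 0 · tail g ⊕ tail f ⊗ g) ⊗ h) n
    ≡⟨ cong (((f 0 ℙ.* g 0) ℙ.* h (suc n)) ℙ.+_)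
         (trans (⊗-distribʳ h (f 0 · tail g) (tail f ⊗ g) n)
                (cong₂ ℙ._+_ (·-⊗-assoc (f 0) (tail g) h n) (⊗-assoc (tail f) g h n))) ⟩
  (f 0 ℙ.* g 0) ℙ.* h (suc n) ℙ.+ ((f 0 ℙ.* (tail g ⊗ h) n) ℙ.+ (tail f ⊗ (g ⊗ h)) n)
    ≡⟨ sym (ℙₚ.+-assoc ((f 0 ℙ.* g 0) ℙ.* h (suc n)) (f 0 ℙ.* (tail g ⊗ h) n) ((tail f ⊗ (g ⊗ h)) n)) ⟩
  ((f 0 ℙ.* g 0) ℙ.* h (suc n) ℙ.+ (f 0 ℙ.* (tail g ⊗ h) n)) ℙ.+ (tail f ⊗ (g ⊗ h)) n
    ≡⟨ cong (ℙ._+ (tail f ⊗ (g ⊗ h)) n)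
         (trans (cong (ℙ._+ (f 0 ℙ.* (tail g ⊗ h) n)) (ℙₚ.*-assoc (f 0) (g 0) (h (suc n))))
                (sym (ℙₚ.*-distribˡ-+ (f 0) (g 0 ℙ.* h (suc n)) ((tail g ⊗ h) n)))) ⟩
  f 0 ℙ.* (g ⊗ h) (suc n) ℙ.+ (tail f ⊗ (g ⊗ h)) n ∎
  where open ≡-Reasoning

⊗-suc : ∀ f g n → (f ⊗ g) (suc n) ≡ f (suc n) ℙ.* g 0 ℙ.+ (f ⊗ tail g) n
⊗-suc f g zero = ℙₚ.+-comm (f 0 ℙ.* g 1) (f 1 ℙ.* g 0)
⊗-suc f g (suc n) =
  trans (cong ((f 0 ℙ.* g (suc (suc n))) ℙ.+_) (⊗-suc (tail f) g n))
        (x∙yz≈y∙xz (f 0 ℙ.* g (suc (suc n))) (f (suc (suc n)) ℙ.* g 0) ((tail f ⊗ tail g) n))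

⊗-comm : ∀ f g → f ⊗ g ≈ g ⊗ f
⊗-comm f g zero = ℙₚ.*-comm (f 0) (g 0)
⊗-comm f g (suc n) =
  trans (cong₂ ℙ._+_ (ℙₚ.*-comm (f 0) (g (suc n))) (⊗-comm (tail f) g n)) (sym (⊗-suc g f n))

⊗-identityʳ : ∀ g → g ⊗ 1ₛ ≈ g
⊗-identityʳ g n = trans (⊗-comm g 1ₛ n) (⊗-identityˡ g n)

seriesRing : CommutativeRing 0ℓ 0ℓ
seriesRing = record
  { Carrier = Series
  ; _≈_ = _≈_
  ; _+_ = _⊕_
  ; _*_ = _⊗_
  ; -_ = λ f → f
  ; 0# = 0ₛ
  ; 1# = 1ₛ
  ; isCommutativeRing = record
    { isRing = record
      { +-isAbelianGroup = Pointwise.isAbelianGroup ℕ ℙₚ.+-0-isAbelianGroup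
      ; *-cong = ⊗-cong
      ; *-assoc = ⊗-assoc
      ; *-identity = ⊗-identityˡ , ⊗-identityʳ
      ; distrib = ⊗-distribˡ , ⊗-distribʳ
      }
    ; *-comm = ⊗-comm
    }
  }

open CommutativeRing seriesRing
  using (setoid; +-cong; +-identityʳ; zeroʳ)
  renaming (refl to ≈-refl; sym to ≈-sym; trans to ≈-trans)

⊕-congˡ : ∀ a {b b′} → b ≈ b′ → a ⊕ b ≈ a ⊕ b′
⊕-congˡ a b≈b′ n = cong (a n ℙ.+_) (b≈b′ n)

⊕-congʳ : ∀ b {a a′} → a ≈ a′ → a ⊕ b ≈ a′ ⊕ b
⊕-congʳ b a≈a′ n = cong (ℙ._+ b n) (a≈a′ n)

module SeriesSolver where

  constant : Parity → Series
  constant c = c · 1ₛ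

  constant-homomorphism : CommutativeRing.rawRing ℙₚ.+-*-commutativeRing
                            ACR.-Raw-AlmostCommutative⟶ ACR.fromCommutativeRing seriesRing
  constant-homomorphism = record
    { ⟦_⟧ = constant
    ; +-homo = λ a b n → ℙₚ.*-distribʳ-+ (1ₛ n) a b
    ; *-homo = λ a b n → trans (ℙₚ.*-assoc a b (1ₛ n))
                           (sym (trans (·-⊗-assoc a 1ₛ (constant b) n)
                                       (cong (a ℙ.*_) (⊗-identityˡ (constant b) n))))
    ; -‿homo = λ _ _ → refl
    ; 0-homo = λ _ → refl
    ; 1-homo = λ _ → refl
    }

  constant-≟ : (a b : Parity) → Maybe (constant a ≈ constant b)
  constant-≟ a b with a ℙₚ.≟ b
  ... | yes refl = just ≈-refl
  ... | no _ = nothing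

  open import Algebra.Solver.Ring (CommutativeRing.rawRing ℙₚ.+-*-commutativeRing)
    (ACR.fromCommutativeRing seriesRing) constant-homomorphism constant-≟ public
    using (solve; _:+_; _:*_; _:=_; con)

open SeriesSolver using (solve; _:+_; _:*_; _:=_; con)

module ≈-Reasoning = SetoidReasoning setoid

infix 10 _²
_² : Series → Series
a ² = a ⊗ a

²-⊕ : ∀ a b → (a ⊕ b) ² ≈ a ² ⊕ b ²
²-⊕ = solve 2 (λ a b → (a :+ b) :* (a :+ b) := a :* a :+ b :* b) ≈-refl

²-cong : ∀ {a b} → a ≈ b → a ² ≈ b ²
²-cong a≈b = ⊗-cong a≈b a≈b

q^-cong : ∀ {a b} → a ≡ b → q^ a ≈ q^ b
q^-cong refl = ≈-refl

q^-+ : ∀ a b → q^ a ⊗ q^ b ≈ q^ (a + b)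
q^-+ zero b = ⊗-identityˡ (q^ b)
q^-+ (suc a) b zero = refl
q^-+ (suc a) b (suc n) = q^-+ a b n

q^-+-≡ : ∀ a b c d → a + b ≡ c + d → q^ a ⊗ q^ b ≈ q^ c ⊗ q^ d
q^-+-≡ a b c d eq = ≈-trans (q^-+ a b) (≈-trans (q^-cong eq) (≈-sym (q^-+ c d)))

q^-coeff-≡ : ∀ a → (q^ a) a ≡ 1ℙ
q^-coeff-≡ zero = refl
q^-coeff-≡ (suc a) = q^-coeff-≡ a

q^-coeff-≢ : ∀ {a n} → a ≢ n → (q^ a) n ≡ 0ℙ
q^-coeff-≢ {zero} {zero} a≢n = ⊥-elim (a≢n refl)
q^-coeff-≢ {zero} {suc n} _ = refl
q^-coeff-≢ {suc a} {zero} _ = refl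
q^-coeff-≢ {suc a} {suc n} a≢n = q^-coeff-≢ (a≢n ∘ cong suc)

q^-⊗-below : ∀ k f {n} → n < k → (q^ k ⊗ f) n ≡ 0ℙ
q^-⊗-below (suc k) f {zero} _ = refl
q^-⊗-below (suc k) f {suc n} (s≤s n<k) = q^-⊗-below k f n<k

q^-⊗-above : ∀ k f {n} → k ≤ n → (q^ k ⊗ f) n ≡ f (n ∸ k)
q^-⊗-above zero f {n} _ = ⊗-identityˡ f n
q^-⊗-above (suc k) f {suc n} (s≤s k≤n) = q^-⊗-above k f k≤n

infix 4 _≈[_]_
_≈[_]_ : Series → ℕ → Series → Set
f ≈[ N ] g = ∀ n → n ≤ N → f n ≡ g n

≈⇒≈[] : ∀ {f g} N → f ≈ g → f ≈[ N ] g
≈⇒≈[] N f≈g n _ = f≈g n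

≈[]-refl : ∀ {N f} → f ≈[ N ] f
≈[]-refl n _ = refl

≈[]-sym : ∀ {N f g} → f ≈[ N ] g → g ≈[ N ] f
≈[]-sym f≈g n n≤N = sym (f≈g n n≤N)

≈[]-trans : ∀ {N f g h} → f ≈[ N ] g → g ≈[ N ] h → f ≈[ N ] h
≈[]-trans f≈g g≈h n n≤N = trans (f≈g n n≤N) (g≈h n n≤N)

⊕-cong[] : ∀ {N a a′ b b′} → a ≈[ N ] a′ → b ≈[ N ] b′ → a ⊕ b ≈[ N ] a′ ⊕ b′
⊕-cong[] a≈a′ b≈b′ n n≤N = cong₂ ℙ._+_ (a≈a′ n n≤N) (b≈b′ n n≤N)

⊗-cong-at : ∀ n {f f′ g g′} → f ≈[ n ] f′ → g ≈[ n ] g′ → (f ⊗ g) n ≡ (f′ ⊗ g′) n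
⊗-cong-at zero f≈f′ g≈g′ = cong₂ ℙ._*_ (f≈f′ 0 z≤n) (g≈g′ 0 z≤n)
⊗-cong-at (suc n) f≈f′ g≈g′ =
  cong₂ ℙ._+_ (cong₂ ℙ._*_ (f≈f′ 0 z≤n) (g≈g′ (suc n) ℕₚ.≤-refl))
              (⊗-cong-at n (λ i i≤n → f≈f′ (suc i) (s≤s i≤n)) (λ i i≤n → g≈g′ i (ℕₚ.m≤n⇒m≤1+n i≤n)))

⊗-cong[] : ∀ {N a a′ b b′} → a ≈[ N ] a′ → b ≈[ N ] b′ → a ⊗ b ≈[ N ] a′ ⊗ b′
⊗-cong[] a≈a′ b≈b′ n n≤N =
  ⊗-cong-at n (λ i i≤n → a≈a′ i (ℕₚ.≤-trans i≤n n≤N)) (λ i i≤n → b≈b′ i (ℕₚ.≤-trans i≤n n≤N))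

q^-⊗-≈[]0ₛ : ∀ {N} k f → N < k → q^ k ⊗ f ≈[ N ] 0ₛ
q^-⊗-≈[]0ₛ k f N<k n n≤N = q^-⊗-below k f (ℕₚ.≤-<-trans n≤N N<k)

⊕-≈[]0ₛ : ∀ {N} g {h} → h ≈[ N ] 0ₛ → g ⊕ h ≈[ N ] g
⊕-≈[]0ₛ g h≈0 n n≤N = trans (cong (g n ℙ.+_) (h≈0 n n≤N)) (ℙₚ.+-identityʳ (g n))

q^-⊗-cong[] : ∀ {N} k {f g} → (k ≤ N → f ≈[ N ] g) → q^ k ⊗ f ≈[ N ] q^ k ⊗ g
q^-⊗-cong[] {N} k {f} {g} f≈g with k ≤? N
... | yes k≤N = ⊗-cong[] ≈[]-refl (f≈g k≤N)
... | no k≰N = ≈[]-trans (q^-⊗-≈[]0ₛ k f N<k) (≈[]-sym (q^-⊗-≈[]0ₛ k g N<k))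
  where N<k = ℕₚ.≰⇒> k≰N

≈[]-setoid : ℕ → Setoid 0ℓ 0ℓ
≈[]-setoid N = record
  { Carrier = Series
  ; _≈_ = _≈[ N ]_
  ; isEquivalence = record { refl = ≈[]-refl ; sym = ≈[]-sym ; trans = ≈[]-trans }
  }

module ≈[]-Reasoning (N : ℕ) = SetoidReasoning (≈[]-setoid N)

∑ : ℕ → (ℕ → Series) → Series
∑ zero F = 0ₛ
∑ (suc n) F = F 0 ⊕ ∑ n (λ i → F (suc i))

∑-cong : ∀ n {F G : ℕ → Series} → (∀ i → F i ≈ G i) → ∑ n F ≈ ∑ n G
∑-cong zero F≈G = ≈-refl
∑-cong (suc n) F≈G = +-cong (F≈G 0) (∑-cong n (λ i → F≈G (suc i)))

∑-cong[] : ∀ {N} n {F G : ℕ → Series} → (∀ i → F i ≈[ N ] G i) → ∑ n F ≈[ N ] ∑ n G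
∑-cong[] zero F≈G = ≈[]-refl
∑-cong[] (suc n) F≈G = ⊕-cong[] (F≈G 0) (∑-cong[] n (λ i → F≈G (suc i)))

∑-suc : ∀ n F → ∑ (suc n) F ≈ ∑ n F ⊕ F n
∑-suc zero F k = ℙₚ.+-comm (F 0 k) 0ℙ
∑-suc (suc n) F k =
  trans (cong (F 0 k ℙ.+_) (∑-suc n (λ i → F (suc i)) k)) (sym (ℙₚ.+-assoc (F 0 k) _ _))

∑-suc-vanishing : ∀ n F → F n ≈ 0ₛ → ∑ (suc n) F ≈ ∑ n F
∑-suc-vanishing n F Fn≈0 = ≈-trans (∑-suc n F) (≈-trans (⊕-congˡ (∑ n F) Fn≈0) (+-identityʳ (∑ n F)))

∑-⊕ : ∀ n F G → ∑ n (λ i → F i ⊕ G i) ≈ ∑ n F ⊕ ∑ n G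
∑-⊕ zero F G k = refl
∑-⊕ (suc n) F G k =
  trans (cong ((F 0 k ℙ.+ G 0 k) ℙ.+_) (∑-⊕ n (λ i → F (suc i)) (λ i → G (suc i)) k))
        (interchange (F 0 k) (G 0 k) (∑ n (λ i → F (suc i)) k) (∑ n (λ i → G (suc i)) k))

⊗-∑ : ∀ n c F → c ⊗ ∑ n F ≈ ∑ n (λ i → c ⊗ F i)
⊗-∑ zero c F = zeroʳ c
⊗-∑ (suc n) c F = ≈-trans (⊗-distribˡ c (F 0) _) (⊕-congˡ (c ⊗ F 0) (⊗-∑ n c (λ i → F (suc i))))

∑-⊗ : ∀ n c F → ∑ n F ⊗ c ≈ ∑ n (λ i → F i ⊗ c)
∑-⊗ n c F = ≈-trans (⊗-comm _ c) (≈-trans (⊗-∑ n c F) (∑-cong n (λ i → ⊗-comm c (F i))))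

∑-0ₛ : ∀ n {F} → (∀ i → F i ≈ 0ₛ) → ∑ n F ≈ 0ₛ
∑-0ₛ zero F≈0 = ≈-refl
∑-0ₛ (suc n) F≈0 = ≈-trans (+-cong (F≈0 0) (∑-0ₛ n (λ i → F≈0 (suc i)))) (+-identityʳ 0ₛ)

∑-² : ∀ n F → (∑ n F) ² ≈ ∑ n (λ i → F i ²)
∑-² zero F = ⊗-zeroˡ 0ₛ
∑-² (suc n) F = ≈-trans (²-⊕ (F 0) _) (⊕-congˡ (F 0 ²) (∑-² n (λ i → F (suc i))))

∑-⊗-∑ : ∀ n m F G → ∑ n F ⊗ ∑ m G ≈ ∑ n (λ i → ∑ m (λ j → F i ⊗ G j))
∑-⊗-∑ n m F G = ≈-trans (∑-⊗ n (∑ m G) F) (∑-cong n (λ i → ⊗-∑ m (F i) G))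

∑∑-diagonals : ∀ G (h : ℕ → ℕ → Series) →
  (∀ a b → G ≤ a → h a b ≈ 0ₛ) → (∀ a b → G ≤ b → h a b ≈ 0ₛ) →
  ∑ G (λ a → ∑ G (h a)) ≈
  ∑ G (λ k → ∑ G (λ j → h (j + k) j)) ⊕ ∑ G (λ k → ∑ G (λ j → h j (suc (j + k))))
∑∑-diagonals zero h _ _ _ = refl
∑∑-diagonals (suc G) h h≈0₁ h≈0₂ = begin
  (h 0 0 ⊕ row) ⊕ ∑ G (λ a → h (suc a) 0 ⊕ ∑ G (h′ a))
    ≈⟨ ⊕-congˡ (h 0 0 ⊕ row) (≈-trans (∑-⊕ G (λ a → h (suc a) 0) (λ a → ∑ G (h′ a)))
                                       (⊕-congˡ column inner)) ⟩
  (h 0 0 ⊕ row) ⊕ (column ⊕ (∑ G below ⊕ ∑ G above))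
    ≈⟨ solve 5 (λ x r c b a → (x :+ r) :+ (c :+ (b :+ a)) := ((x :+ c) :+ b) :+ (r :+ a)) ≈-refl
         (h 0 0) row column (∑ G below) (∑ G above) ⟩
  ((h 0 0 ⊕ column) ⊕ ∑ G below) ⊕ (row ⊕ ∑ G above)
    ≈⟨ +-cong (≈-sym lower) (≈-sym upper) ⟩
  ∑ (suc G) (λ k → ∑ (suc G) (λ j → h (j + k) j)) ⊕ ∑ (suc G) (λ k → ∑ (suc G) (λ j → h j (suc (j + k)))) ∎
  where
  open ≈-Reasoning
  h′ : ℕ → ℕ → Series
  h′ a b = h (suc a) (suc b)
  row column : Series
  row = ∑ G (λ b → h 0 (suc b))
  column = ∑ G (λ a → h (suc a) 0)
  below above : ℕ → Series
  below k = ∑ G (λ j → h′ (j + k) j)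
  above k = ∑ G (λ j → h′ j (suc (j + k)))
  inner : ∑ G (λ a → ∑ G (h′ a)) ≈ ∑ G below ⊕ ∑ G above
  inner = ∑∑-diagonals G h′ (λ a b G≤a → h≈0₁ (suc a) (suc b) (s≤s G≤a))
                            (λ a b G≤b → h≈0₂ (suc a) (suc b) (s≤s G≤b))
  lower : ∑ (suc G) (λ k → h k 0 ⊕ below k) ≈ (h 0 0 ⊕ column) ⊕ ∑ G below
  lower = ≈-trans (∑-⊕ (suc G) (λ k → h k 0) below)
            (⊕-congˡ (h 0 0 ⊕ column) (∑-suc-vanishing G below
              (∑-0ₛ G (λ j → h≈0₁ (suc (j + G)) (suc j) (s≤s (ℕₚ.m≤n+m G j))))))
  upper : ∑ (suc G) (λ k → h 0 (suc k) ⊕ above k) ≈ row ⊕ ∑ G above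
  upper = ≈-trans (∑-⊕ (suc G) (λ k → h 0 (suc k)) above)
            (+-cong (∑-suc-vanishing G (λ k → h 0 (suc k)) (h≈0₂ 0 (suc G) ℕₚ.≤-refl))
                    (∑-suc-vanishing G above
                      (∑-0ₛ G (λ j → h≈0₂ (suc j) (suc (suc (j + G)))
                                         (s≤s (ℕₚ.m≤n⇒m≤1+n (ℕₚ.m≤n+m G j)))))))

≈[]-stabilises : ∀ {N L} (F : ℕ → Series) → (∀ M → L ≤ M → F (suc M) ≈[ N ] F M) →
                 ∀ {M} → L ≤ M → F M ≈[ N ] F L
≈[]-stabilises {N} {L} F step L≤M = go (ℕₚ.≤⇒≤′ L≤M)
  where
  go : ∀ {M} → L ≤′ M → F M ≈[ N ] F L
  go ≤′-refl = ≈[]-refl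
  go (≤′-step {M} L≤′M) = ≈[]-trans (step M (ℕₚ.≤′⇒≤ L≤′M)) (go L≤′M)

<-progression : ∀ a b {N m} → N ≤ m → N < suc a * m + suc b
<-progression a b {N} {m} N≤m = begin-strict
  N                 ≤⟨ N≤m ⟩
  m                 ≤⟨ ℕₚ.m≤m*n m (suc a) ⟩
  m * suc a         ≡⟨ ℕₚ.*-comm m (suc a) ⟩
  suc a * m         <⟨ ℕₚ.m<m+n (suc a * m) (s≤s z≤n) ⟩
  suc a * m + suc b ∎
  where open ℕₚ.≤-Reasoning

-- Products over arithmetic progressions

progression-shift : ∀ α β M → α * suc M + β ≡ α * M + (α + β)
progression-shift = solve-∀

-- elem α β M j is the coefficient of zʲ in ∏_{m<M} (1 + z q^(αm+β)).
elem : ℕ → ℕ → ℕ → ℕ → Series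
elem α β zero zero = 1ₛ
elem α β zero (suc j) = 0ₛ
elem α β (suc M) zero = 1ₛ
elem α β (suc M) (suc j) = elem α β M (suc j) ⊕ q^ (α * M + β) ⊗ elem α β M j

prod : ℕ → ℕ → ℕ → Series
prod α β zero = 1ₛ
prod α β (suc M) = prod α β M ⊗ (1ₛ ⊕ q^ (α * M + β))

elem-zero : ∀ α β M → elem α β M 0 ≈ 1ₛ
elem-zero α β zero = ≈-refl
elem-zero α β (suc M) = ≈-refl

elem-vanish : ∀ α β {M j} → M < j → elem α β M j ≈ 0ₛ
elem-vanish α β {zero} {suc j} _ = ≈-refl
elem-vanish α β {suc M} {suc j} (s≤s M<j) = begin
  elem α β M (suc j) ⊕ q^ (α * M + β) ⊗ elem α β M j
    ≈⟨ +-cong (elem-vanish α β (ℕₚ.m≤n⇒m≤1+n M<j))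
              (⊗-congˡ (q^ (α * M + β)) (elem-vanish α β M<j)) ⟩
  0ₛ ⊕ q^ (α * M + β) ⊗ 0ₛ
    ≈⟨ zeroʳ (q^ (α * M + β)) ⟩
  0ₛ ∎
  where open ≈-Reasoning

∑-elem : ∀ α β {M G} → M < G → ∑ G (elem α β M) ≈ prod α β M
∑-elem α β {zero} {suc G} _ = ≈-trans (⊕-congˡ 1ₛ (∑-0ₛ G (λ _ → ≈-refl))) (+-identityʳ 1ₛ)
∑-elem α β {suc M} {suc G} (s≤s M<G) = begin
  1ₛ ⊕ ∑ G (λ i → elem α β M (suc i) ⊕ x ⊗ elem α β M i)
    ≈⟨ ⊕-congˡ 1ₛ (≈-trans (∑-⊕ G (λ i → elem α β M (suc i)) (λ i → x ⊗ elem α β M i))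
                           (⊕-congˡ (∑ G (λ i → elem α β M (suc i))) (≈-sym (⊗-∑ G x (elem α β M))))) ⟩
  1ₛ ⊕ (∑ G (λ i → elem α β M (suc i)) ⊕ x ⊗ ∑ G (elem α β M))
    ≈⟨ solve 3 (λ u s t → u :+ (s :+ t) := (u :+ s) :+ t) ≈-refl 1ₛ _ _ ⟩
  (1ₛ ⊕ ∑ G (λ i → elem α β M (suc i))) ⊕ x ⊗ ∑ G (elem α β M)
    ≈⟨ ⊕-congʳ (x ⊗ ∑ G (elem α β M)) (⊕-congʳ (∑ G (λ i → elem α β M (suc i))) (≈-sym (elem-zero α β M))) ⟩
  ∑ (suc G) (elem α β M) ⊕ x ⊗ ∑ G (elem α β M)
    ≈⟨ +-cong (∑-elem α β (ℕₚ.m≤n⇒m≤1+n M<G)) (⊗-congˡ x (∑-elem α β M<G)) ⟩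
  prod α β M ⊕ x ⊗ prod α β M
    ≈⟨ solve 2 (λ p x → p :+ x :* p := p :* (con 1ℙ :+ x)) ≈-refl (prod α β M) x ⟩
  prod α β (suc M) ∎
  where
  open ≈-Reasoning
  x = q^ (α * M + β)

elem-peel-first : ∀ α β M j →
  elem α β (suc M) (suc j) ≈ elem α (α + β) M (suc j) ⊕ q^ β ⊗ elem α (α + β) M j
elem-peel-first α β zero zero = ⊕-congˡ 0ₛ (⊗-congʳ 1ₛ (q^-cong (cong (_+ β) (ℕₚ.*-zeroʳ α))))
elem-peel-first α β zero (suc j) = ⊕-congˡ 0ₛ (⊗-congʳ 0ₛ (q^-cong (cong (_+ β) (ℕₚ.*-zeroʳ α))))
elem-peel-first α β (suc M) zero = begin
  elem α β (suc M) 1 ⊕ q^ (α * suc M + β) ⊗ 1ₛ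
    ≈⟨ +-cong (elem-peel-first α β M zero)
              (⊗-cong (q^-cong (progression-shift α β M)) (≈-sym (elem-zero α (α + β) M))) ⟩
  elem α (α + β) M 1 ⊕ y ⊗ u ⊕ x ⊗ u
    ≈⟨ solve 4 (λ a u x y → a :+ y :* u :+ x :* u := a :+ x :* u :+ y :* u) ≈-refl
         (elem α (α + β) M 1) u x y ⟩
  elem α (α + β) (suc M) 1 ⊕ y ⊗ u
    ≈⟨ ⊕-congˡ (elem α (α + β) (suc M) 1) (⊗-congˡ y (elem-zero α (α + β) M)) ⟩
  elem α (α + β) (suc M) 1 ⊕ y ⊗ 1ₛ ∎
  where
  open ≈-Reasoning
  u = elem α (α + β) M 0
  x = q^ (α * M + (α + β))
  y = q^ β
elem-peel-first α β (suc M) (suc j) = begin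
  elem α β (suc M) (suc (suc j)) ⊕ q^ (α * suc M + β) ⊗ elem α β (suc M) (suc j)
    ≈⟨ +-cong (elem-peel-first α β M (suc j))
              (⊗-cong (q^-cong (progression-shift α β M)) (elem-peel-first α β M j)) ⟩
  (e (suc (suc j)) ⊕ y ⊗ e (suc j)) ⊕ x ⊗ (e (suc j) ⊕ y ⊗ e j)
    ≈⟨ solve 5 (λ a b c x y → (a :+ y :* b) :+ x :* (b :+ y :* c) := (a :+ x :* b) :+ y :* (b :+ x :* c))
         ≈-refl (e (suc (suc j))) (e (suc j)) (e j) x y ⟩
  elem α (α + β) (suc M) (suc (suc j)) ⊕ y ⊗ elem α (α + β) (suc M) (suc j) ∎
  where
  open ≈-Reasoning
  e = elem α (α + β) M
  x = q^ (α * M + (α + β))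
  y = q^ β

elem-offset : ∀ α β γ M j → elem α (γ + β) M j ≈ q^ (γ * j) ⊗ elem α β M j
elem-offset α β γ M zero =
  ≈-trans (elem-zero α (γ + β) M)
          (≈-sym (≈-trans (⊗-cong (q^-cong (ℕₚ.*-zeroʳ γ)) (elem-zero α β M)) (⊗-identityˡ 1ₛ)))
elem-offset α β γ zero (suc j) = ≈-sym (zeroʳ (q^ (γ * suc j)))
elem-offset α β γ (suc M) (suc j) = begin
  elem α (γ + β) M (suc j) ⊕ q^ (α * M + (γ + β)) ⊗ elem α (γ + β) M j
    ≈⟨ +-cong (elem-offset α β γ M (suc j)) (⊗-congˡ (q^ (α * M + (γ + β))) (elem-offset α β γ M j)) ⟩
  q^ (γ * suc j) ⊗ elem α β M (suc j) ⊕ q^ (α * M + (γ + β)) ⊗ (q^ (γ * j) ⊗ elem α β M j)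
    ≈⟨ ⊕-congˡ (q^ (γ * suc j) ⊗ elem α β M (suc j)) (≈-sym (⊗-assoc _ _ _)) ⟩
  q^ (γ * suc j) ⊗ elem α β M (suc j) ⊕ (q^ (α * M + (γ + β)) ⊗ q^ (γ * j)) ⊗ elem α β M j
    ≈⟨ ⊕-congˡ (q^ (γ * suc j) ⊗ elem α β M (suc j))
         (⊗-congʳ (elem α β M j) (q^-+-≡ (α * M + (γ + β)) (γ * j) (γ * suc j) (α * M + β) (exponents α β γ M j))) ⟩
  q^ (γ * suc j) ⊗ elem α β M (suc j) ⊕ (q^ (γ * suc j) ⊗ q^ (α * M + β)) ⊗ elem α β M j
    ≈⟨ solve 4 (λ x a w c → x :* a :+ (x :* w) :* c := x :* (a :+ w :* c)) ≈-refl
         (q^ (γ * suc j)) (elem α β M (suc j)) (q^ (α * M + β)) (elem α β M j) ⟩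
  q^ (γ * suc j) ⊗ elem α β (suc M) (suc j) ∎
  where
  open ≈-Reasoning
  exponents : ∀ α β γ M j → α * M + (γ + β) + γ * j ≡ γ * suc j + (α * M + β)
  exponents = solve-∀

elem-peel : ∀ α β M j →
  elem α β (suc M) (suc j) ≈ q^ (α * suc j) ⊗ elem α β M (suc j) ⊕ q^ (α * j + β) ⊗ elem α β M j
elem-peel α β M j = begin
  elem α β (suc M) (suc j)
    ≈⟨ elem-peel-first α β M j ⟩
  elem α (α + β) M (suc j) ⊕ q^ β ⊗ elem α (α + β) M j
    ≈⟨ +-cong (elem-offset α β α M (suc j)) (⊗-congˡ (q^ β) (elem-offset α β α M j)) ⟩
  q^ (α * suc j) ⊗ elem α β M (suc j) ⊕ q^ β ⊗ (q^ (α * j) ⊗ elem α β M j)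
    ≈⟨ ⊕-congˡ (q^ (α * suc j) ⊗ elem α β M (suc j))
         (≈-trans (≈-sym (⊗-assoc (q^ β) (q^ (α * j)) (elem α β M j)))
                  (⊗-congʳ (elem α β M j) (≈-trans (q^-+ β (α * j)) (q^-cong (ℕₚ.+-comm β (α * j)))))) ⟩
  q^ (α * suc j) ⊗ elem α β M (suc j) ⊕ q^ (α * j + β) ⊗ elem α β M j ∎
  where open ≈-Reasoning

q^-² : ∀ k → (q^ k) ² ≈ q^ (k + k)
q^-² k = q^-+ k k

elem-² : ∀ α β M j → (elem α β M j) ² ≈ elem (α + α) (β + β) M j
elem-² α β zero zero = ⊗-identityˡ 1ₛ
elem-² α β zero (suc j) = ⊗-zeroˡ 0ₛ
elem-² α β (suc M) zero = ⊗-identityˡ 1ₛ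
elem-² α β (suc M) (suc j) = begin
  (elem α β M (suc j) ⊕ q^ (α * M + β) ⊗ elem α β M j) ²
    ≈⟨ solve 3 (λ a x c → (a :+ x :* c) :* (a :+ x :* c) := a :* a :+ (x :* x) :* (c :* c)) ≈-refl
         (elem α β M (suc j)) (q^ (α * M + β)) (elem α β M j) ⟩
  (elem α β M (suc j)) ² ⊕ (q^ (α * M + β)) ² ⊗ (elem α β M j) ²
    ≈⟨ +-cong (elem-² α β M (suc j))
              (⊗-cong (≈-trans (q^-² (α * M + β)) (q^-cong (doubled α β M))) (elem-² α β M j)) ⟩
  elem (α + α) (β + β) (suc M) (suc j) ∎
  where
  open ≈-Reasoning
  doubled : ∀ α β M → α * M + β + (α * M + β) ≡ (α + α) * M + (β + β)
  doubled = solve-∀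

elem-stable : ∀ a b j {N M} → N ≤ M → elem (suc a) (suc b) M j ≈[ N ] elem (suc a) (suc b) N j
elem-stable a b zero {N} {M} _ =
  ≈⇒≈[] N (≈-trans (elem-zero (suc a) (suc b) M) (≈-sym (elem-zero (suc a) (suc b) N)))
elem-stable a b (suc j) {N} = ≈[]-stabilises (λ M → elem (suc a) (suc b) M (suc j)) step
  where
  step : ∀ M → N ≤ M → elem (suc a) (suc b) (suc M) (suc j) ≈[ N ] elem (suc a) (suc b) M (suc j)
  step M N≤M = ⊕-≈[]0ₛ _ (q^-⊗-≈[]0ₛ (suc a * M + suc b) _ (<-progression a b N≤M))

prod-stable : ∀ a b {N M} → N ≤ M → prod (suc a) (suc b) M ≈[ N ] prod (suc a) (suc b) N
prod-stable a b {N} = ≈[]-stabilises (prod (suc a) (suc b)) step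
  where
  step : ∀ M → N ≤ M → prod (suc a) (suc b) (suc M) ≈[ N ] prod (suc a) (suc b) M
  step M N≤M = ≈[]-trans (≈⇒≈[] N (solve 2 (λ p x → p :* (con 1ℙ :+ x) := p :+ x :* p) ≈-refl _ _))
                             (⊕-≈[]0ₛ _ (q^-⊗-≈[]0ₛ (suc a * M + suc b) _ (<-progression a b N≤M)))

-- Jacobi's triple product modulo 2

module Charge (b b′ : ℕ) where

  β β′ α : ℕ
  β = suc b
  β′ = suc b′
  α = β + β′

  A B : ℕ → ℕ → Series
  A = elem α β
  B = elem α β′

  -- The coefficient of zᵏ in ∏_{m<M} (1 + z q^(αm+β)) · ∏_{m<M′} (1 + z⁻¹ q^(αm+β′)),
  -- with the sum over the power j of z⁻¹ cut off at G.
  charge : ℕ → ℕ → ℕ → ℕ → Series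
  charge G M M′ k = ∑ G (λ j → A M (k + j) ⊗ B M′ j)

  peel-B : ∀ M M′ k i →
    q^ (α * k + β) ⊗ (A M (k + suc i) ⊗ B (suc M′) (suc i)) ≈
    q^ (α * (k + suc i) + β) ⊗ (A M (k + suc i) ⊗ B M′ (suc i)) ⊕ q^ (α * suc (k + i)) ⊗ (A M (suc (k + i)) ⊗ B M′ i)
  peel-B M M′ k i = begin
    X ⊗ (a ⊗ B (suc M′) (suc i))
      ≈⟨ ⊗-congˡ X (⊗-congˡ a (elem-peel α β′ M′ i)) ⟩
    X ⊗ (a ⊗ (u ⊗ B M′ (suc i) ⊕ v ⊗ B M′ i))
      ≈⟨ solve 6 (λ x a u b v c → x :* (a :* (u :* b :+ v :* c)) := (x :* u) :* (a :* b) :+ (x :* v) :* (a :* c))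
           ≈-refl X a u (B M′ (suc i)) v (B M′ i) ⟩
    (X ⊗ u) ⊗ (a ⊗ B M′ (suc i)) ⊕ (X ⊗ v) ⊗ (a ⊗ B M′ i)
      ≈⟨ +-cong (⊗-congʳ (a ⊗ B M′ (suc i)) (≈-trans (q^-+ (α * k + β) (α * suc i)) (q^-cong (inner-exponent α β k i))))
                (⊗-cong (≈-trans (q^-+ (α * k + β) (α * i + β′)) (q^-cong (outer-exponent b b′ k i)))
                        (⊗-congʳ (B M′ i) (λ n → cong (λ l → A M l n) (ℕₚ.+-suc k i)))) ⟩
    q^ (α * (k + suc i) + β) ⊗ (a ⊗ B M′ (suc i)) ⊕ q^ (α * suc (k + i)) ⊗ (A M (suc (k + i)) ⊗ B M′ i) ∎
    where
    open ≈-Reasoning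
    X = q^ (α * k + β)
    a = A M (k + suc i)
    u = q^ (α * suc i)
    v = q^ (α * i + β′)
    inner-exponent : ∀ α β k i → α * k + β + α * suc i ≡ α * (k + suc i) + β
    inner-exponent = solve-∀
    outer-exponent : ∀ b b′ k i → (suc b + suc b′) * k + suc b + ((suc b + suc b′) * i + suc b′)
                                  ≡ (suc b + suc b′) * suc (k + i)
    outer-exponent = solve-∀

  charge-step : ∀ G M M′ k → M′ < G →
    charge (suc G) (suc M) M′ (suc k) ≈ q^ (α * k + β) ⊗ charge (suc G) M (suc M′) k
  charge-step G M M′ k M′<G = begin
    ∑ (suc G) (λ j → A (suc M) (suc (k + j)) ⊗ B M′ j)
      ≈⟨ ∑-cong (suc G) peel-A ⟩
    ∑ (suc G) (λ j → outer j ⊕ inner j)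
      ≈⟨ ∑-⊕ (suc G) outer inner ⟩
    ∑ (suc G) outer ⊕ ∑ (suc G) inner
      ≈⟨ ⊕-congʳ (∑ (suc G) inner) (∑-suc-vanishing G outer outer-G≈0) ⟩
    ∑ G outer ⊕ (inner 0 ⊕ ∑ G (λ i → inner (suc i)))
      ≈⟨ solve 3 (λ o h r → o :+ (h :+ r) := h :+ (r :+ o)) ≈-refl (∑ G outer) (inner 0) _ ⟩
    inner 0 ⊕ (∑ G (λ i → inner (suc i)) ⊕ ∑ G outer)
      ≈⟨ +-cong (≈-sym head) (≈-trans (≈-sym (∑-⊕ G (λ i → inner (suc i)) outer)) (∑-cong G (λ i → ≈-sym (peel-B M M′ k i)))) ⟩
    X ⊗ (A M (k + 0) ⊗ B (suc M′) 0) ⊕ ∑ G (λ i → X ⊗ (A M (k + suc i) ⊗ B (suc M′) (suc i)))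
      ≈⟨ ≈-sym (⊗-∑ (suc G) X (λ i → A M (k + i) ⊗ B (suc M′) i)) ⟩
    X ⊗ charge (suc G) M (suc M′) k ∎
    where
    open ≈-Reasoning
    X = q^ (α * k + β)
    outer inner : ℕ → Series
    outer j = q^ (α * suc (k + j)) ⊗ (A M (suc (k + j)) ⊗ B M′ j)
    inner j = q^ (α * (k + j) + β) ⊗ (A M (k + j) ⊗ B M′ j)
    peel-A : ∀ j → A (suc M) (suc (k + j)) ⊗ B M′ j ≈ outer j ⊕ inner j
    peel-A j = ≈-trans (⊗-congʳ (B M′ j) (elem-peel α β M (k + j)))
                       (solve 5 (λ x a y c b → (x :* a :+ y :* c) :* b := x :* (a :* b) :+ y :* (c :* b)) ≈-refl
                          (q^ (α * suc (k + j))) (A M (suc (k + j))) (q^ (α * (k + j) + β)) (A M (k + j)) (B M′ j))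
    outer-G≈0 : outer G ≈ 0ₛ
    outer-G≈0 = ≈-trans (⊗-congˡ (q^ (α * suc (k + G)))
                          (≈-trans (⊗-congˡ (A M (suc (k + G))) (elem-vanish α β′ M′<G)) (zeroʳ _)))
                        (zeroʳ _)
    head : X ⊗ (A M (k + 0) ⊗ B (suc M′) 0) ≈ inner 0
    head = ⊗-cong (q^-cong (cong (λ i → α * i + β) (sym (ℕₚ.+-identityʳ k))))
                  (⊗-congˡ (A M (k + 0)) (≈-sym (elem-zero α β′ M′)))
  chargeExponent : ℕ → ℕ
  chargeExponent zero = 0
  chargeExponent (suc k) = α * k + β + chargeExponent k

  ≤-chargeExponent : ∀ k → k ≤ chargeExponent k
  ≤-chargeExponent zero = z≤n
  ≤-chargeExponent (suc k) = begin
    suc k                             ≤⟨ s≤s (≤-chargeExponent k) ⟩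
    suc (chargeExponent k)            ≤⟨ ℕₚ.m≤n+m _ (α * k + b) ⟩
    α * k + b + suc (chargeExponent k) ≡⟨ ℕₚ.+-suc (α * k + b) _ ⟩
    suc (α * k + b) + chargeExponent k ≡⟨ cong (_+ chargeExponent k) (sym (ℕₚ.+-suc (α * k) b)) ⟩
    chargeExponent (suc k)            ∎
    where open ℕₚ.≤-Reasoning

  charge-iterate : ∀ G k M M′ → M′ + k < G →
    charge (suc G) (k + M) M′ k ≈ q^ (chargeExponent k) ⊗ charge (suc G) M (k + M′) 0
  charge-iterate G zero M M′ _ = ≈-sym (⊗-identityˡ _)
  charge-iterate G (suc k) M M′ M′+k<G = begin
    charge (suc G) (suc (k + M)) M′ (suc k)
      ≈⟨ charge-step G (k + M) M′ k (ℕₚ.≤-<-trans (ℕₚ.m≤m+n M′ (suc k)) M′+k<G) ⟩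
    q^ (α * k + β) ⊗ charge (suc G) (k + M) (suc M′) k
      ≈⟨ ⊗-congˡ (q^ (α * k + β)) (charge-iterate G k M (suc M′) (subst (_< G) (ℕₚ.+-suc M′ k) M′+k<G)) ⟩
    q^ (α * k + β) ⊗ (q^ (chargeExponent k) ⊗ charge (suc G) M (k + suc M′) 0)
      ≈⟨ ≈-sym (⊗-assoc _ _ _) ⟩
    (q^ (α * k + β) ⊗ q^ (chargeExponent k)) ⊗ charge (suc G) M (k + suc M′) 0
      ≈⟨ ⊗-cong (q^-+ (α * k + β) (chargeExponent k)) (λ n → cong (λ m → charge (suc G) M m 0 n) (ℕₚ.+-suc k M′)) ⟩
    q^ (chargeExponent (suc k)) ⊗ charge (suc G) M (suc k + M′) 0 ∎
    where open ≈-Reasoning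

  charge-limit : ∀ {N M G} → N + N ≤ M → M + M < G → ∀ k →
    charge (suc G) M M k ≈[ N ] q^ (chargeExponent k) ⊗ ∑ (suc G) (λ j → A N j ⊗ B N j)
  charge-limit {N} {M} {G} N+N≤M M+M<G k with M <? k
  ... | yes M<k = ≈[]-trans (≈⇒≈[] N vanishes) (≈[]-sym (q^-⊗-≈[]0ₛ (chargeExponent k) _ N<E))
    where
    vanishes : charge (suc G) M M k ≈ 0ₛ
    vanishes = ∑-0ₛ (suc G) (λ j → ≈-trans (⊗-congʳ (B M j) (elem-vanish α β (ℕₚ.<-≤-trans M<k (ℕₚ.m≤m+n k j))))
                                           (⊗-zeroˡ _))
    N<E : N < chargeExponent k
    N<E = ℕₚ.≤-<-trans (ℕₚ.≤-trans (ℕₚ.m≤m+n N N) N+N≤M) (ℕₚ.<-≤-trans M<k (≤-chargeExponent k))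
  ... | no M≮k = ≈[]-trans (≈⇒≈[] N (≈-trans split (charge-iterate G k (M ∸ k) M M+k<G)))
                           (q^-⊗-cong[] (chargeExponent k) stable)
    where
    k≤M : k ≤ M
    k≤M = ℕₚ.≮⇒≥ M≮k
    split : charge (suc G) M M k ≈ charge (suc G) (k + (M ∸ k)) M k
    split n = cong (λ m → charge (suc G) m M k n) (sym (ℕₚ.m+[n∸m]≡n k≤M))
    M+k<G : M + k < G
    M+k<G = ℕₚ.≤-<-trans (ℕₚ.+-monoʳ-≤ M k≤M) M+M<G
    stable : chargeExponent k ≤ N → charge (suc G) (M ∸ k) (k + M) 0 ≈[ N ] ∑ (suc G) (λ j → A N j ⊗ B N j)
    stable E≤N = ∑-cong[] (suc G) (λ j → ⊗-cong[] (elem-stable (b + suc b′) b j N≤M∸k)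
                                                   (elem-stable (b + suc b′) b′ j N≤k+M))
      where
      k≤N = ℕₚ.≤-trans (≤-chargeExponent k) E≤N
      N≤M∸k : N ≤ M ∸ k
      N≤M∸k = ℕₚ.m+n≤o⇒m≤o∸n N (ℕₚ.≤-trans (ℕₚ.+-monoʳ-≤ N k≤N) N+N≤M)
      N≤k+M : N ≤ k + M
      N≤k+M = ℕₚ.≤-trans (ℕₚ.≤-trans (ℕₚ.m≤m+n N N) N+N≤M) (ℕₚ.m≤n+m M k)

triangular : ℕ → ℕ
triangular zero = 0
triangular (suc m) = triangular m + suc m

θ : ℕ → Series
θ K = ∑ K (λ m → q^ triangular m)

m≤triangular : ∀ m → m ≤ triangular m
m≤triangular zero = z≤n
m≤triangular (suc m) = ℕₚ.m≤n+m (suc m) (triangular m)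

θ-stable : ∀ {N K} → N < K → θ K ≈[ N ] θ (suc N)
θ-stable {N} = ≈[]-stabilises θ step
  where
  step : ∀ K → N < K → θ (suc K) ≈[ N ] θ K
  step K N<K = ≈[]-trans (≈⇒≈[] N (∑-suc K (λ m → q^ triangular m)))
                         (⊕-≈[]0ₛ (θ K) (λ n n≤N → q^-coeff-≢ (ℕₚ.>⇒≢ (ℕₚ.≤-<-trans n≤N (ℕₚ.<-≤-trans N<K (m≤triangular K))))))

∑-pairs : ∀ K F → ∑ K (λ k → F (k + k) ⊕ F (suc (k + k))) ≈ ∑ (K + K) F
∑-pairs zero F = ≈-refl
∑-pairs (suc K) F = begin
  (F 0 ⊕ F 1) ⊕ ∑ K (λ k → F (suc k + suc k) ⊕ F (suc (suc k + suc k)))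
    ≈⟨ ⊕-congˡ (F 0 ⊕ F 1) (∑-cong K (λ k n → cong (λ i → (F (suc i) ⊕ F (suc (suc i))) n) (ℕₚ.+-suc k k))) ⟩
  (F 0 ⊕ F 1) ⊕ ∑ K (λ k → F (suc (suc (k + k))) ⊕ F (suc (suc (suc (k + k)))))
    ≈⟨ ⊕-congˡ (F 0 ⊕ F 1) (∑-pairs K (λ i → F (suc (suc i)))) ⟩
  (F 0 ⊕ F 1) ⊕ ∑ (K + K) (λ i → F (suc (suc i)))
    ≈⟨ (λ n → ℙₚ.+-assoc (F 0 n) (F 1 n) _) ⟩
  ∑ (suc (suc (K + K))) F
    ≈⟨ (λ n → cong (λ i → ∑ (suc i) F n) (sym (ℕₚ.+-suc K K))) ⟩
  ∑ (suc K + suc K) F ∎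
  where open ≈-Reasoning

module C₃₁ = Charge 2 0
module C₁₃ = Charge 0 2

C₃₁-exponent : ∀ k → C₃₁.chargeExponent k ≡ triangular (k + k)
C₃₁-exponent zero = refl
C₃₁-exponent (suc k) = begin
  4 * k + 3 + C₃₁.chargeExponent k ≡⟨ cong (4 * k + 3 +_) (C₃₁-exponent k) ⟩
  4 * k + 3 + triangular (k + k)   ≡⟨ step (triangular (k + k)) k ⟩
  triangular (k + k) + suc (k + k) + suc (suc (k + k)) ≡⟨ cong (λ i → triangular (suc i)) (sym (ℕₚ.+-suc k k)) ⟩
  triangular (suc k + suc k) ∎
  where
  open ≡-Reasoning
  step : ∀ t k → 4 * k + 3 + t ≡ t + suc (k + k) + suc (suc (k + k))
  step = solve-∀

C₁₃-exponent : ∀ k → C₁₃.chargeExponent (suc k) ≡ triangular (suc (k + k))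
C₁₃-exponent zero = refl
C₁₃-exponent (suc k) = begin
  4 * suc k + 1 + C₁₃.chargeExponent (suc k) ≡⟨ cong (4 * suc k + 1 +_) (C₁₃-exponent k) ⟩
  4 * suc k + 1 + triangular (suc (k + k))   ≡⟨ step (triangular (suc (k + k))) k ⟩
  triangular (suc (k + k)) + suc (suc (k + k)) + suc (suc (suc (k + k))) ≡⟨ cong (λ i → triangular (suc (suc i))) (sym (ℕₚ.+-suc k k)) ⟩
  triangular (suc (suc k + suc k)) ∎
  where
  open ≡-Reasoning
  step : ∀ t k → 4 * suc k + 1 + t ≡ t + suc (suc (k + k)) + suc (suc (suc (k + k)))
  step = solve-∀

prod-odd-split : ∀ M → prod 2 1 (M + M) ≈ prod 4 3 M ⊗ prod 4 1 M
prod-odd-split zero = ≈-sym (⊗-identityˡ 1ₛ)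
prod-odd-split (suc M) = begin
  prod 2 1 (suc M + suc M)
    ≈⟨ (λ n → cong (λ i → prod 2 1 (suc i) n) (ℕₚ.+-suc M M)) ⟩
  prod 2 1 (M + M) ⊗ (1ₛ ⊕ q^ (2 * (M + M) + 1)) ⊗ (1ₛ ⊕ q^ (2 * suc (M + M) + 1))
    ≈⟨ ⊗-cong (⊗-cong (prod-odd-split M) (⊕-congˡ 1ₛ (q^-cong (first M)))) (⊕-congˡ 1ₛ (q^-cong (second M))) ⟩
  prod 4 3 M ⊗ prod 4 1 M ⊗ (1ₛ ⊕ q^ (4 * M + 1)) ⊗ (1ₛ ⊕ q^ (4 * M + 3))
    ≈⟨ solve 4 (λ a b x y → a :* b :* (con 1ℙ :+ x) :* (con 1ℙ :+ y) := a :* (con 1ℙ :+ y) :* (b :* (con 1ℙ :+ x)))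
         ≈-refl (prod 4 3 M) (prod 4 1 M) (q^ (4 * M + 1)) (q^ (4 * M + 3)) ⟩
  prod 4 3 (suc M) ⊗ prod 4 1 (suc M) ∎
  where
  open ≈-Reasoning
  first : ∀ M → 2 * (M + M) + 1 ≡ 4 * M + 1
  first = solve-∀
  second : ∀ M → 2 * suc (M + M) + 1 ≡ 4 * M + 3
  second = solve-∀

-- Frobenius: the offset 2j turns elem 4 3 ⊗ elem 4 1 into the fourth power of elem 2 1.
∑-elem⊗elem : ∀ {N G} → N < G → ∑ G (λ j → elem 4 3 N j ⊗ elem 4 1 N j) ≈ (prod 2 1 N) ² ²
∑-elem⊗elem {N} {G} N<G = begin
  ∑ G (λ j → elem 4 3 N j ⊗ elem 4 1 N j)     ≈⟨ ∑-cong G term ⟩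
  ∑ G (λ j → (elem 2 1 N j) ² ²)              ≈⟨ ≈-sym (∑-² G (λ j → (elem 2 1 N j) ²)) ⟩
  (∑ G (λ j → (elem 2 1 N j) ²)) ²            ≈⟨ ²-cong (≈-sym (∑-² G (elem 2 1 N))) ⟩
  (∑ G (elem 2 1 N)) ² ²                      ≈⟨ ²-cong (²-cong (∑-elem 2 1 N<G)) ⟩
  (prod 2 1 N) ² ² ∎
  where
  open ≈-Reasoning
  term : ∀ j → elem 4 3 N j ⊗ elem 4 1 N j ≈ (elem 2 1 N j) ² ²
  term j = begin
    elem 4 3 N j ⊗ elem 4 1 N j               ≈⟨ ⊗-congʳ (elem 4 1 N j) (elem-offset 4 1 2 N j) ⟩
    q^ (2 * j) ⊗ elem 4 1 N j ⊗ elem 4 1 N j  ≈⟨ ⊗-assoc _ _ _ ⟩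
    q^ (2 * j) ⊗ (elem 4 1 N j) ²             ≈⟨ ⊗-congˡ (q^ (2 * j)) (elem-² 4 1 N j) ⟩
    q^ (2 * j) ⊗ elem 8 2 N j                 ≈⟨ ≈-sym (elem-offset 8 2 2 N j) ⟩
    elem 8 4 N j                              ≈⟨ ≈-sym (elem-² 4 2 N j) ⟩
    (elem 4 2 N j) ²                          ≈⟨ ≈-sym (²-cong (elem-² 2 1 N j)) ⟩
    (elem 2 1 N j) ² ² ∎

prod-odd-charges : ∀ {M G} → M < G →
  prod 2 1 (M + M) ≈ ∑ G (C₃₁.charge G M M) ⊕ ∑ G (λ k → C₁₃.charge G M M (suc k))
prod-odd-charges {M} {G} M<G = begin
  prod 2 1 (M + M)
    ≈⟨ prod-odd-split M ⟩
  prod 4 3 M ⊗ prod 4 1 M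
    ≈⟨ ≈-sym (⊗-cong (∑-elem 4 3 M<G) (∑-elem 4 1 M<G)) ⟩
  ∑ G (U M) ⊗ ∑ G (V M)
    ≈⟨ ∑-⊗-∑ G G (U M) (V M) ⟩
  ∑ G (λ a → ∑ G (λ b → U M a ⊗ V M b))
    ≈⟨ ∑∑-diagonals G (λ a b → U M a ⊗ V M b)
         (λ a b G≤a → ≈-trans (⊗-congʳ (V M b) (elem-vanish 4 3 (ℕₚ.<-≤-trans M<G G≤a))) (⊗-zeroˡ _))
         (λ a b G≤b → ≈-trans (⊗-congˡ (U M a) (elem-vanish 4 1 (ℕₚ.<-≤-trans M<G G≤b))) (zeroʳ _)) ⟩
  ∑ G (λ k → ∑ G (λ j → U M (j + k) ⊗ V M j)) ⊕ ∑ G (λ k → ∑ G (λ j → U M j ⊗ V M (suc (j + k))))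
    ≈⟨ +-cong (∑-cong G (λ k → ∑-cong G (λ j n → cong (λ i → (U M i ⊗ V M j) n) (ℕₚ.+-comm j k))))
              (∑-cong G (λ k → ∑-cong G (λ j → ≈-trans (⊗-comm (U M j) _)
                                                   (λ n → cong (λ i → (V M (suc i) ⊗ U M j) n) (ℕₚ.+-comm j k))))) ⟩
  ∑ G (C₃₁.charge G M M) ⊕ ∑ G (λ k → C₁₃.charge G M M (suc k)) ∎
  where
  open ≈-Reasoning
  U V : ℕ → ℕ → Series
  U = elem 4 3
  V = elem 4 1

θ-⊗-split : ∀ G Q →
  θ (G + G) ⊗ Q ≈ ∑ G (λ k → q^ triangular (k + k) ⊗ Q) ⊕ ∑ G (λ k → q^ triangular (suc (k + k)) ⊗ Q)
θ-⊗-split G Q = begin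
  θ (G + G) ⊗ Q
    ≈⟨ ⊗-congʳ Q (≈-sym (∑-pairs G (λ m → q^ triangular m))) ⟩
  ∑ G (λ k → q^ triangular (k + k) ⊕ q^ triangular (suc (k + k))) ⊗ Q
    ≈⟨ ∑-⊗ G Q (λ k → q^ triangular (k + k) ⊕ q^ triangular (suc (k + k))) ⟩
  ∑ G (λ k → (q^ triangular (k + k) ⊕ q^ triangular (suc (k + k))) ⊗ Q)
    ≈⟨ ∑-cong G (λ k → ⊗-distribʳ Q (q^ triangular (k + k)) (q^ triangular (suc (k + k)))) ⟩
  ∑ G (λ k → q^ triangular (k + k) ⊗ Q ⊕ q^ triangular (suc (k + k)) ⊗ Q)
    ≈⟨ ∑-⊕ G (λ k → q^ triangular (k + k) ⊗ Q) (λ k → q^ triangular (suc (k + k)) ⊗ Q) ⟩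
  ∑ G (λ k → q^ triangular (k + k) ⊗ Q) ⊕ ∑ G (λ k → q^ triangular (suc (k + k)) ⊗ Q) ∎
  where open ≈-Reasoning

jacobi-mod2 : ∀ N → θ (suc N) ⊗ (prod 2 1 N) ² ² ≈[ N ] prod 2 1 N
jacobi-mod2 N = begin
  θ (suc N) ⊗ (prod 2 1 N) ² ²
    ≈⟨ ⊗-cong[] (≈[]-sym (θ-stable N<G+G)) (≈⇒≈[] N (≈-sym (∑-elem⊗elem N<G))) ⟩
  θ (G + G) ⊗ Q
    ≈⟨ ≈⇒≈[] N (θ-⊗-split G Q) ⟩
  ∑ G (λ k → q^ triangular (k + k) ⊗ Q) ⊕ ∑ G (λ k → q^ triangular (suc (k + k)) ⊗ Q)
    ≈⟨ ≈[]-sym charges ⟩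
  ∑ G (C₃₁.charge G M M) ⊕ ∑ G (λ k → C₁₃.charge G M M (suc k))
    ≈⟨ ≈⇒≈[] N (≈-sym (prod-odd-charges M<G)) ⟩
  prod 2 1 (M + M)
    ≈⟨ prod-stable 1 0 (ℕₚ.≤-trans (ℕₚ.m≤m+n N N) (ℕₚ.m≤m+n M M)) ⟩
  prod 2 1 N ∎
  where
  open ≈[]-Reasoning N
  M G : ℕ
  M = N + N
  G = suc (suc (M + M))
  Q : Series
  Q = ∑ G (λ j → elem 4 3 N j ⊗ elem 4 1 N j)
  M<G : M < G
  M<G = s≤s (ℕₚ.≤-trans (ℕₚ.m≤m+n M M) (ℕₚ.n≤1+n (M + M)))
  N<G : N < G
  N<G = ℕₚ.≤-<-trans (ℕₚ.m≤m+n N N) M<G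
  N<G+G : N < G + G
  N<G+G = ℕₚ.<-≤-trans N<G (ℕₚ.m≤m+n G G)
  charges : ∑ G (C₃₁.charge G M M) ⊕ ∑ G (λ k → C₁₃.charge G M M (suc k))
            ≈[ N ] ∑ G (λ k → q^ triangular (k + k) ⊗ Q) ⊕ ∑ G (λ k → q^ triangular (suc (k + k)) ⊗ Q)
  charges = ⊕-cong[]
    (∑-cong[] G (λ k → ≈[]-trans (C₃₁.charge-limit ℕₚ.≤-refl ℕₚ.≤-refl k)
                                 (≈⇒≈[] N (⊗-congʳ Q (q^-cong (C₃₁-exponent k))))))
    (∑-cong[] G (λ k → ≈[]-trans (C₁₃.charge-limit ℕₚ.≤-refl ℕₚ.≤-refl (suc k))
                                 (≈⇒≈[] N (⊗-cong (q^-cong (C₁₃-exponent k))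
                                                  (∑-cong G (λ j → ⊗-comm (elem 4 1 N j) (elem 4 3 N j)))))))

-- Partitions into odd parts

oddPart : ℕ → ℕ
oddPart b = 2 * b + 1

1≤oddPart : ∀ b → 1 ≤ oddPart b
1≤oddPart b = ℕₚ.m≤n+m 1 (2 * b)

∸-oddPart-≤ : ∀ b {n f} → n ≤ suc f → n ∸ oddPart b ≤ f
∸-oddPart-≤ b {n} n≤1+f = ℕₚ.≤-trans (ℕₚ.∸-monoʳ-≤ n (1≤oddPart b)) (ℕₚ.m≤n+o⇒m∸n≤o n 1 n≤1+f)

oddPart-indivisible : ∀ b → ¬ (2 ∣ oddPart b)
oddPart-indivisible b (divides k eq) with
  trans (sym (ℙₚ.+-homo-+ (2 * b) 1)) (trans (cong parity eq) (ℙₚ.*-homo-* k 2))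
... | odd≡even rewrite ℙₚ.*-homo-* 2 b | ℙₚ.*-zeroʳ (parity k) = case odd≡even of λ ()

consOddPart : ℕ → ℕ → (ℕ → List (List ℕ)) → List (List ℕ)
consOddPart b n F with oddPart b ≤? n
... | yes _ = map (oddPart b ∷_) (F (n ∸ oddPart b))
... | no _ = []

-- The partitions of n into odd parts below 2b, in decreasing order; the fuel f ≥ n makes the
-- recursion structural.
oddPartitions : ℕ → ℕ → ℕ → List (List ℕ)
oddPartitions f zero zero = [] ∷ []
oddPartitions f zero (suc n) = []
oddPartitions zero (suc b) n = oddPartitions zero b n
oddPartitions (suc f) (suc b) n = oddPartitions (suc f) b n ++ consOddPart b n (oddPartitions f (suc b))

consOddPart-≰ : ∀ b n F → ¬ (oddPart b ≤ n) → consOddPart b n F ≡ []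
consOddPart-≰ b n F p≰n with oddPart b ≤? n
... | yes p≤n = ⊥-elim (p≰n p≤n)
... | no _ = refl

consOddPart-length : ∀ b n F → oddPart b ≤ n → length (consOddPart b n F) ≡ length (F (n ∸ oddPart b))
consOddPart-length b n F p≤n with oddPart b ≤? n
... | yes _ = length-map (oddPart b ∷_) (F (n ∸ oddPart b))
... | no p≰n = ⊥-elim (p≰n p≤n)

consOddPart-cong : ∀ b n {F F′} → (oddPart b ≤ n → F (n ∸ oddPart b) ≡ F′ (n ∸ oddPart b)) →
                   consOddPart b n F ≡ consOddPart b n F′
consOddPart-cong b n F≡F′ with oddPart b ≤? n
... | yes p≤n = cong (map (oddPart b ∷_)) (F≡F′ p≤n)
... | no _ = refl

∈-consOddPart⁻ : ∀ b n F {t} → t ∈ consOddPart b n F →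
                 ∃ λ t′ → t ≡ oddPart b ∷ t′ × t′ ∈ F (n ∸ oddPart b) × oddPart b ≤ n
∈-consOddPart⁻ b n F t∈ with oddPart b ≤? n
... | yes p≤n = let t′ , t′∈ , eq = ∈-map⁻ (oddPart b ∷_) t∈ in t′ , eq , t′∈ , p≤n

∈-consOddPart⁺ : ∀ b n F {t} → oddPart b ≤ n → t ∈ F (n ∸ oddPart b) → oddPart b ∷ t ∈ consOddPart b n F
∈-consOddPart⁺ b n F p≤n t∈ with oddPart b ≤? n
... | yes _ = ∈-map⁺ (oddPart b ∷_) t∈
... | no p≰n = ⊥-elim (p≰n p≤n)

consOddPart-unique : ∀ b n F → Unique (F (n ∸ oddPart b)) → Unique (consOddPart b n F)
consOddPart-unique b n F unique with oddPart b ≤? n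
... | yes _ = Uniqueₚ.map⁺ ∷-injectiveʳ unique
... | no _ = []

oddPartitions-fuel-suc : ∀ f b n → n ≤ f → oddPartitions f b n ≡ oddPartitions (suc f) b n
oddPartitions-fuel-suc f zero zero _ = refl
oddPartitions-fuel-suc f zero (suc n) _ = refl
oddPartitions-fuel-suc zero (suc b) zero _ = begin
  oddPartitions 0 b 0                                     ≡⟨ oddPartitions-fuel-suc zero b zero z≤n ⟩
  oddPartitions 1 b 0                                     ≡⟨ sym (++-identityʳ _) ⟩
  oddPartitions 1 b 0 ++ []                               ≡⟨ cong (oddPartitions 1 b 0 ++_) (sym (consOddPart-≰ b 0 _ p≰0)) ⟩
  oddPartitions 1 b 0 ++ consOddPart b 0 (oddPartitions 0 (suc b)) ∎
  where
  open ≡-Reasoning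
  p≰0 : ¬ (oddPart b ≤ 0)
  p≰0 p≤0 = case ℕₚ.≤-trans (1≤oddPart b) p≤0 of λ ()
oddPartitions-fuel-suc (suc f) (suc b) n n≤1+f =
  cong₂ _++_ (oddPartitions-fuel-suc (suc f) b n n≤1+f)
             (consOddPart-cong b n (λ _ → oddPartitions-fuel-suc f (suc b) (n ∸ oddPart b) (∸-oddPart-≤ b n≤1+f)))

oddPartitions-fuel : ∀ {f} b n → n ≤ f → oddPartitions f b n ≡ oddPartitions n b n
oddPartitions-fuel b n n≤f = go (ℕₚ.≤⇒≤′ n≤f)
  where
  go : ∀ {f} → n ≤′ f → oddPartitions f b n ≡ oddPartitions n b n
  go ≤′-refl = refl
  go (≤′-step {f} n≤′f) = trans (sym (oddPartitions-fuel-suc f b n (ℕₚ.≤′⇒≤ n≤′f))) (go n≤′f)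

PartitionBelow : ℕ → ℕ → List ℕ → Set
PartitionBelow b n t = IsRegularPartition 2 n t × All (_< 2 * b) t

2*suc : ∀ b → 2 * suc b ≡ suc (2 * b + 1)
2*suc = solve-∀

oddPart≡suc : ∀ b → oddPart b ≡ suc (2 * b)
oddPart≡suc b = ℕₚ.+-comm (2 * b) 1

[]-below : ∀ b → PartitionBelow b 0 []
[]-below b = (record { decreasing = [] ; positive = [] ; sums = refl } , []) , []

below-suc : ∀ b {n t} → PartitionBelow b n t → PartitionBelow (suc b) n t
below-suc b (regular , bounded) = regular , All.map (λ x<2b → ℕₚ.<-≤-trans x<2b 2b≤2[1+b]) bounded
  where
  2b≤2[1+b] : 2 * b ≤ 2 * suc b
  2b≤2[1+b] = ℕₚ.*-monoʳ-≤ 2 (ℕₚ.n≤1+n b)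

∷-linked : ∀ {x t} → Linked _≥_ t → All (_≤ x) t → Linked _≥_ (x ∷ t)
∷-linked {t = []} _ _ = [-]
∷-linked {t = _ ∷ _} decreasing (y≤x ∷ _) = y≤x ∷ decreasing

∷-below : ∀ b {n t} → oddPart b ≤ n → PartitionBelow (suc b) (n ∸ oddPart b) t →
          PartitionBelow (suc b) n (oddPart b ∷ t)
∷-below b {n} {t} p≤n ((partition , regular) , bounded) =
  (record { decreasing = ∷-linked (IsPartition.decreasing partition)
                                  (All.map (λ {x} x<2[1+b] → ℕₚ.≤-pred (subst (x <_) (2*suc b) x<2[1+b])) bounded)
          ; positive = 1≤oddPart b ∷ IsPartition.positive partition
          ; sums = trans (cong (oddPart b +_) (IsPartition.sums partition)) (ℕₚ.m+[n∸m]≡n p≤n) }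
  , oddPart-indivisible b ∷ regular)
  , subst (oddPart b <_) (sym (2*suc b)) ℕₚ.≤-refl ∷ bounded

oddPartitions-sound : ∀ f b n {t} → t ∈ oddPartitions f b n → PartitionBelow b n t
oddPartitions-sound f zero zero (here refl) = []-below 0
oddPartitions-sound zero (suc b) n t∈ = below-suc b (oddPartitions-sound zero b n t∈)
oddPartitions-sound (suc f) (suc b) n t∈ with ∈-++⁻ (oddPartitions (suc f) b n) t∈
... | inj₁ t∈₁ = below-suc b (oddPartitions-sound (suc f) b n t∈₁)
... | inj₂ t∈₂ with ∈-consOddPart⁻ b n (oddPartitions f (suc b)) t∈₂
...   | t′ , refl , t′∈ , p≤n = ∷-below b p≤n (oddPartitions-sound f (suc b) (n ∸ oddPart b) t′∈)

decreasing⇒≤-head : ∀ {x t} → Linked _≥_ (x ∷ t) → All (_≤ x) (x ∷ t)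
decreasing⇒≤-head {t = []} _ = ℕₚ.≤-refl ∷ []
decreasing⇒≤-head {t = _ ∷ _} (y≤x ∷ decreasing) =
  ℕₚ.≤-refl ∷ All.map (λ z≤y → ℕₚ.≤-trans z≤y y≤x) (decreasing⇒≤-head decreasing)

partition-tail : ∀ {n x t} → IsPartition n (x ∷ t) → IsPartition (n ∸ x) t
partition-tail {x = x} {t} partition = record
  { decreasing = Linked.tail (IsPartition.decreasing partition)
  ; positive = All.tail (IsPartition.positive partition)
  ; sums = trans (sym (ℕₚ.m+n∸m≡n x (sum t))) (cong (_∸ x) (IsPartition.sums partition))
  }

partition-head-≤ : ∀ {n x t} → IsPartition n (x ∷ t) → x ≤ n
partition-head-≤ {x = x} {t} partition =
  ℕₚ.≤-trans (ℕₚ.m≤m+n x (sum t)) (ℕₚ.≤-reflexive (IsPartition.sums partition))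

odd-part-below : ∀ b {x} → x < 2 * suc b → x ≢ oddPart b → ¬ (2 ∣ x) → x < 2 * b
odd-part-below b {x} x<2[1+b] x≢p 2∤x with ℕₚ.m≤n⇒m<n∨m≡n (ℕₚ.≤-pred (subst (x <_) (2*suc b) x<2[1+b]))
... | inj₂ x≡p = ⊥-elim (x≢p x≡p)
... | inj₁ x<p with ℕₚ.m≤n⇒m<n∨m≡n (ℕₚ.≤-pred (subst (x <_) (oddPart≡suc b) x<p))
...   | inj₁ x<2b = x<2b
...   | inj₂ x≡2b = ⊥-elim (2∤x (divides b (trans x≡2b (ℕₚ.*-comm 2 b))))

oddPartitions-complete : ∀ f b n {t} → PartitionBelow b n t → n ≤ f → t ∈ oddPartitions f b n
oddPartitions-complete f zero n {[]} ((partition , _) , _) _ =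
  subst (λ n → [] ∈ oddPartitions f zero n) (IsPartition.sums partition) (here refl)
oddPartitions-complete f zero n {x ∷ t} (_ , () ∷ _) _
oddPartitions-complete zero (suc b) n {[]} ((partition , regular) , _) n≤0 =
  oddPartitions-complete zero b n ((partition , regular) , []) n≤0
oddPartitions-complete (suc f) (suc b) n {[]} ((partition , regular) , _) n≤f =
  ∈-++⁺ˡ (oddPartitions-complete (suc f) b n ((partition , regular) , []) n≤f)
oddPartitions-complete zero (suc b) n {x ∷ t} ((partition , _) , _) n≤0 =
  case ℕₚ.≤-trans (All.head (IsPartition.positive partition)) (ℕₚ.≤-trans (partition-head-≤ partition) n≤0) of λ ()
oddPartitions-complete (suc f) (suc b) n {x ∷ t} ((partition , regular) , x<2[1+b] ∷ bounded) n≤1+f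
  with x ℕₚ.≟ oddPart b
... | yes refl =
  ∈-++⁺ʳ (oddPartitions (suc f) b n)
    (∈-consOddPart⁺ b n (oddPartitions f (suc b)) (partition-head-≤ partition)
      (oddPartitions-complete f (suc b) (n ∸ oddPart b) ((partition-tail partition , All.tail regular) , bounded)
                              (∸-oddPart-≤ b n≤1+f)))
... | no x≢p =
  ∈-++⁺ˡ (oddPartitions-complete (suc f) b n ((partition , regular) , All.map (λ y≤x → ℕₚ.≤-<-trans y≤x x<2b)
                                                   (decreasing⇒≤-head (IsPartition.decreasing partition))) n≤1+f)
  where
  x<2b : x < 2 * b
  x<2b = odd-part-below b x<2[1+b] x≢p (All.head regular)

oddPartitions-unique : ∀ f b n → Unique (oddPartitions f b n)
oddPartitions-unique f zero zero = [] ∷ []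
oddPartitions-unique f zero (suc n) = []
oddPartitions-unique zero (suc b) n = oddPartitions-unique zero b n
oddPartitions-unique (suc f) (suc b) n =
  Uniqueₚ.++⁺ (oddPartitions-unique (suc f) b n)
              (consOddPart-unique b n (oddPartitions f (suc b)) (oddPartitions-unique f (suc b) (n ∸ oddPart b)))
              disjoint
  where
  disjoint : ∀ {t} → ¬ (t ∈ oddPartitions (suc f) b n × t ∈ consOddPart b n (oddPartitions f (suc b)))
  disjoint (t∈₁ , t∈₂) with ∈-consOddPart⁻ b n (oddPartitions f (suc b)) t∈₂
  ... | _ , refl , _ , _ with oddPartitions-sound (suc f) b n t∈₁
  ...   | _ , p<2b ∷ _ = ℕₚ.<-irrefl refl (ℕₚ.<-≤-trans p<2b (ℕₚ.≤-trans (ℕₚ.n≤1+n (2 * b)) (ℕₚ.≤-reflexive (sym (oddPart≡suc b)))))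

paritySeries : {A : Set} → (ℕ → List A) → Series
paritySeries F n = parity (length (F n))

oddPartitionParity : ℕ → Series
oddPartitionParity b = paritySeries (λ n → oddPartitions n b n)

oddPartitionParity-zero : oddPartitionParity 0 ≈ 1ₛ
oddPartitionParity-zero zero = refl
oddPartitionParity-zero (suc n) = refl

oddPartitionParity-suc : ∀ b →
  oddPartitionParity (suc b) ≈ oddPartitionParity b ⊕ q^ (2 * b + 1) ⊗ oddPartitionParity (suc b)
oddPartitionParity-suc b zero =
  sym (trans (cong (oddPartitionParity b 0 ℙ.+_) (q^-⊗-below (oddPart b) (oddPartitionParity (suc b)) (1≤oddPart b)))
             (ℙₚ.+-identityʳ _))
oddPartitionParity-suc b (suc n) = begin
  parity (length (oddPartitions (suc n) b (suc n) ++ with-p))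
    ≡⟨ cong parity (length-++ (oddPartitions (suc n) b (suc n))) ⟩
  parity (length (oddPartitions (suc n) b (suc n)) + length with-p)
    ≡⟨ ℙₚ.+-homo-+ (length (oddPartitions (suc n) b (suc n))) (length with-p) ⟩
  oddPartitionParity b (suc n) ℙ.+ parity (length with-p)
    ≡⟨ cong (oddPartitionParity b (suc n) ℙ.+_) (with-p-parity (oddPart b ≤? suc n)) ⟩
  oddPartitionParity b (suc n) ℙ.+ (q^ (2 * b + 1) ⊗ oddPartitionParity (suc b)) (suc n) ∎
  where
  open ≡-Reasoning
  with-p = consOddPart b (suc n) (oddPartitions n (suc b))
  with-p-parity : Dec (oddPart b ≤ suc n) → parity (length with-p) ≡ (q^ (2 * b + 1) ⊗ oddPartitionParity (suc b)) (suc n)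
  with-p-parity (yes p≤1+n) = begin
    parity (length with-p)
      ≡⟨ cong parity (consOddPart-length b (suc n) _ p≤1+n) ⟩
    parity (length (oddPartitions n (suc b) (suc n ∸ oddPart b)))
      ≡⟨ cong (parity ∘ length) (oddPartitions-fuel (suc b) (suc n ∸ oddPart b) (∸-oddPart-≤ b ℕₚ.≤-refl)) ⟩
    oddPartitionParity (suc b) (suc n ∸ oddPart b)
      ≡⟨ sym (q^-⊗-above (oddPart b) (oddPartitionParity (suc b)) p≤1+n) ⟩
    (q^ (2 * b + 1) ⊗ oddPartitionParity (suc b)) (suc n) ∎
  with-p-parity (no p≰1+n) = begin
    parity (length with-p)
      ≡⟨ cong (parity ∘ length) (consOddPart-≰ b (suc n) _ p≰1+n) ⟩
    0ℙ
      ≡⟨ sym (q^-⊗-below (oddPart b) (oddPartitionParity (suc b)) (ℕₚ.≰⇒> p≰1+n)) ⟩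
    (q^ (2 * b + 1) ⊗ oddPartitionParity (suc b)) (suc n) ∎

prod-⊗-oddPartitionParity : ∀ b → prod 2 1 b ⊗ oddPartitionParity b ≈ 1ₛ
prod-⊗-oddPartitionParity zero = ≈-trans (⊗-identityˡ _) oddPartitionParity-zero
prod-⊗-oddPartitionParity (suc b) = begin
  prod 2 1 b ⊗ (1ₛ ⊕ x) ⊗ P
    ≈⟨ ⊗-assoc (prod 2 1 b) (1ₛ ⊕ x) P ⟩
  prod 2 1 b ⊗ ((1ₛ ⊕ x) ⊗ P)
    ≈⟨ ⊗-congˡ (prod 2 1 b) (solve 2 (λ x p → (con 1ℙ :+ x) :* p := p :+ x :* p) ≈-refl x P) ⟩
  prod 2 1 b ⊗ (P ⊕ x ⊗ P)
    ≈⟨ ⊗-congˡ (prod 2 1 b) (≈-trans (⊕-congʳ (x ⊗ P) (oddPartitionParity-suc b))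
                                      (solve 2 (λ p y → p :+ y :+ y := p) ≈-refl (oddPartitionParity b) (x ⊗ P))) ⟩
  prod 2 1 b ⊗ oddPartitionParity b
    ≈⟨ prod-⊗-oddPartitionParity b ⟩
  1ₛ ∎
  where
  open ≈-Reasoning
  x = q^ (2 * b + 1)
  P = oddPartitionParity (suc b)

oddPartitionParity-stable : ∀ {N M} → N ≤ M → oddPartitionParity M ≈[ N ] oddPartitionParity N
oddPartitionParity-stable {N} = ≈[]-stabilises oddPartitionParity step
  where
  step : ∀ M → N ≤ M → oddPartitionParity (suc M) ≈[ N ] oddPartitionParity M
  step M N≤M = ≈[]-trans (≈⇒≈[] N (oddPartitionParity-suc M))
                         (⊕-≈[]0ₛ (oddPartitionParity M) (q^-⊗-≈[]0ₛ (2 * M + 1) _ (<-progression 1 0 N≤M)))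

partition-below : ∀ {n t} → IsPartition n t → All (_< 2 * n) t
partition-below {t = []} _ = []
partition-below {n} {x ∷ _} partition =
  All.map (λ y≤x → ℕₚ.≤-<-trans (ℕₚ.≤-trans y≤x x≤n) n<2n) (decreasing⇒≤-head (IsPartition.decreasing partition))
  where
  x≤n = partition-head-≤ partition
  n<2n : n < 2 * n
  n<2n = subst (n <_) (cong (n +_) (sym (ℕₚ.+-identityʳ n)))
               (ℕₚ.m<m+n n (ℕₚ.≤-trans (All.head (IsPartition.positive partition)) x≤n))

regularPartitions : ℕ → List (List ℕ)
regularPartitions n = oddPartitions n n n

∈-regularPartitions⁻ : ∀ {n t} → t ∈ regularPartitions n → IsRegularPartition 2 n t
∈-regularPartitions⁻ {n} t∈ = proj₁ (oddPartitions-sound n n n t∈)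

∈-regularPartitions⁺ : ∀ {n t} → IsRegularPartition 2 n t → t ∈ regularPartitions n
∈-regularPartitions⁺ {n} (partition , regular) =
  oddPartitions-complete n n n ((partition , regular) , partition-below partition) ℕₚ.≤-refl

regularPartitions-unique : ∀ n → Unique (regularPartitions n)
regularPartitions-unique n = oddPartitions-unique n n n

regularPartitions-disjoint : ∀ {t m n} → t ∈ regularPartitions m → t ∈ regularPartitions n → m ≡ n
regularPartitions-disjoint t∈m t∈n =
  trans (sym (IsPartition.sums (proj₁ (∈-regularPartitions⁻ t∈m)))) (IsPartition.sums (proj₁ (∈-regularPartitions⁻ t∈n)))

paritySeries-regularPartitions : ∀ N → paritySeries regularPartitions ≈[ N ] oddPartitionParity N
paritySeries-regularPartitions N n n≤N = sym (oddPartitionParity-stable n≤N n ℕₚ.≤-refl)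

-- Triples of partitions

convolve : {A B : Set} → (ℕ → List A) → (ℕ → List B) → ℕ → List (A × B)
convolve F G zero = cartesianProduct (F 0) (G 0)
convolve F G (suc n) = cartesianProduct (F 0) (G (suc n)) ++ convolve (F ∘ suc) G n

length-cartesianProduct : {A B : Set} (xs : List A) (ys : List B) →
                          length (cartesianProduct xs ys) ≡ length xs * length ys
length-cartesianProduct [] ys = refl
length-cartesianProduct (x ∷ xs) ys =
  trans (length-++ (map (x ,_) ys)) (cong₂ _+_ (length-map (x ,_) ys) (length-cartesianProduct xs ys))

parity-length-cartesianProduct : {A B : Set} (xs : List A) (ys : List B) →
  parity (length (cartesianProduct xs ys)) ≡ parity (length xs) ℙ.* parity (length ys)
parity-length-cartesianProduct xs ys =
  trans (cong parity (length-cartesianProduct xs ys)) (ℙₚ.*-homo-* (length xs) (length ys))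

paritySeries-convolve : {A B : Set} (F : ℕ → List A) (G : ℕ → List B) →
                        paritySeries (convolve F G) ≈ paritySeries F ⊗ paritySeries G
paritySeries-convolve F G zero = parity-length-cartesianProduct (F 0) (G 0)
paritySeries-convolve F G (suc n) = begin
  parity (length (cartesianProduct (F 0) (G (suc n)) ++ convolve (F ∘ suc) G n))
    ≡⟨ cong parity (length-++ (cartesianProduct (F 0) (G (suc n)))) ⟩
  parity (length (cartesianProduct (F 0) (G (suc n))) + length (convolve (F ∘ suc) G n))
    ≡⟨ ℙₚ.+-homo-+ (length (cartesianProduct (F 0) (G (suc n)))) _ ⟩
  parity (length (cartesianProduct (F 0) (G (suc n)))) ℙ.+ paritySeries (convolve (F ∘ suc) G) n
    ≡⟨ cong₂ ℙ._+_ (parity-length-cartesianProduct (F 0) (G (suc n))) (paritySeries-convolve (F ∘ suc) G n) ⟩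
  (paritySeries F ⊗ paritySeries G) (suc n) ∎
  where open ≡-Reasoning

∈-convolve⁻ : {A B : Set} (F : ℕ → List A) (G : ℕ → List B) → ∀ n {x y} → (x , y) ∈ convolve F G n →
              ∃ λ i → ∃ λ j → i + j ≡ n × x ∈ F i × y ∈ G j
∈-convolve⁻ F G zero xy∈ = let x∈ , y∈ = ∈-cartesianProduct⁻ (F 0) (G 0) xy∈ in 0 , 0 , refl , x∈ , y∈
∈-convolve⁻ F G (suc n) xy∈ with ∈-++⁻ (cartesianProduct (F 0) (G (suc n))) xy∈
... | inj₁ xy∈₁ = let x∈ , y∈ = ∈-cartesianProduct⁻ (F 0) (G (suc n)) xy∈₁ in 0 , suc n , refl , x∈ , y∈
... | inj₂ xy∈₂ = let i , j , i+j≡n , x∈ , y∈ = ∈-convolve⁻ (F ∘ suc) G n xy∈₂ in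
                  suc i , j , cong suc i+j≡n , x∈ , y∈

∈-convolve⁺ : {A B : Set} (F : ℕ → List A) (G : ℕ → List B) → ∀ {i j n x y} →
              i + j ≡ n → x ∈ F i → y ∈ G j → (x , y) ∈ convolve F G n
∈-convolve⁺ F G {zero} {n = zero} refl x∈ y∈ = ∈-cartesianProduct⁺ x∈ y∈
∈-convolve⁺ F G {zero} {n = suc n} refl x∈ y∈ = ∈-++⁺ˡ (∈-cartesianProduct⁺ x∈ y∈)
∈-convolve⁺ F G {suc i} {n = suc n} i+j≡n x∈ y∈ =
  ∈-++⁺ʳ (cartesianProduct (F 0) (G (suc n))) (∈-convolve⁺ (F ∘ suc) G (ℕₚ.suc-injective i+j≡n) x∈ y∈)

convolve-unique : {A B : Set} (F : ℕ → List A) (G : ℕ → List B) → (∀ i → Unique (F i)) → (∀ j → Unique (G j)) →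
                  (∀ {x i i′} → x ∈ F i → x ∈ F i′ → i ≡ i′) → ∀ n → Unique (convolve F G n)
convolve-unique F G F-unique G-unique F-disjoint zero = Uniqueₚ.cartesianProduct⁺ (F-unique 0) (G-unique 0)
convolve-unique F G F-unique G-unique F-disjoint (suc n) =
  Uniqueₚ.++⁺ (Uniqueₚ.cartesianProduct⁺ (F-unique 0) (G-unique (suc n)))
              (convolve-unique (F ∘ suc) G (F-unique ∘ suc) G-unique
                               (λ x∈ x∈′ → ℕₚ.suc-injective (F-disjoint x∈ x∈′)) n)
              disjoint
  where
  disjoint : ∀ {v} → ¬ (v ∈ cartesianProduct (F 0) (G (suc n)) × v ∈ convolve (F ∘ suc) G n)
  disjoint (xy∈₁ , xy∈₂) =
    let x∈F0 , _ = ∈-cartesianProduct⁻ (F 0) (G (suc n)) xy∈₁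
        _ , _ , _ , x∈F[1+i] , _ = ∈-convolve⁻ (F ∘ suc) G n xy∈₂
    in ℕₚ.0≢1+n (F-disjoint x∈F0 x∈F[1+i])

triple : List ℕ × (List ℕ × List ℕ) → Vec (List ℕ) 3
triple (a , b , c) = a ∷ b ∷ c ∷ []

triple-injective : ∀ {u v} → triple u ≡ triple v → u ≡ v
triple-injective {_ , _ , _} {_ , _ , _} refl = refl

regularTriples : ℕ → List (Vec (List ℕ) 3)
regularTriples n = map triple (convolve regularPartitions (convolve regularPartitions regularPartitions) n)

regularTriples-unique : ∀ n → Unique (regularTriples n)
regularTriples-unique n =
  Uniqueₚ.map⁺ triple-injective
    (convolve-unique regularPartitions _ regularPartitions-unique
      (convolve-unique regularPartitions regularPartitions regularPartitions-unique regularPartitions-unique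
                       regularPartitions-disjoint)
      regularPartitions-disjoint n)

∈-regularTriples⁻ : ∀ n t → t ∈ regularTriples n → IsTupleRegPartition 2 3 n t
∈-regularTriples⁻ n t t∈ with ∈-map⁻ triple t∈
... | (a , b , c) , abc∈ , refl with ∈-convolve⁻ regularPartitions _ n abc∈
...   | i , j , i+j≡n , a∈ , bc∈ with ∈-convolve⁻ regularPartitions regularPartitions j bc∈
...     | j₁ , j₂ , j₁+j₂≡j , b∈ , c∈ = (i ∷ j₁ ∷ j₂ ∷ []) , sizes , regular
  where
  sizes : i + (j₁ + (j₂ + 0)) ≡ n
  sizes = trans (cong (λ k → i + (j₁ + k)) (ℕₚ.+-identityʳ j₂)) (trans (cong (i +_) j₁+j₂≡j) i+j≡n)
  regular : ∀ k → IsRegularPartition 2 (Vec.lookup (i ∷ j₁ ∷ j₂ ∷ []) k) (Vec.lookup (a ∷ b ∷ c ∷ []) k)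
  regular zero = ∈-regularPartitions⁻ a∈
  regular (suc zero) = ∈-regularPartitions⁻ b∈
  regular (suc (suc zero)) = ∈-regularPartitions⁻ c∈

∈-regularTriples⁺ : ∀ n t → IsTupleRegPartition 2 3 n t → t ∈ regularTriples n
∈-regularTriples⁺ n (a ∷ b ∷ c ∷ []) ((i ∷ j₁ ∷ j₂ ∷ []) , sizes , regular) =
  ∈-map⁺ triple (∈-convolve⁺ regularPartitions _ {i} {j₁ + j₂} i+j≡n (∈-regularPartitions⁺ (regular zero))
                  (∈-convolve⁺ regularPartitions regularPartitions {j₁} {j₂} refl
                    (∈-regularPartitions⁺ (regular (suc zero))) (∈-regularPartitions⁺ (regular (suc (suc zero))))))
  where
  i+j≡n : i + (j₁ + j₂) ≡ n
  i+j≡n = trans (cong (λ k → i + (j₁ + k)) (sym (ℕₚ.+-identityʳ j₂))) sizes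

regularTriples-enumerates : ∀ n → Enumerates 2 3 n (regularTriples n)
regularTriples-enumerates n = regularTriples-unique n , λ t → mk⇔ (∈-regularTriples⁻ n t) (∈-regularTriples⁺ n t)

paritySeries-regularTriples :
  paritySeries regularTriples ≈ paritySeries regularPartitions ⊗ (paritySeries regularPartitions ⊗ paritySeries regularPartitions)
paritySeries-regularTriples n =
  trans (cong parity (length-map triple (convolve regularPartitions _ n)))
        (trans (paritySeries-convolve regularPartitions (convolve regularPartitions regularPartitions) n)
               (⊗-congˡ e (paritySeries-convolve regularPartitions regularPartitions) n))
  where e = paritySeries regularPartitions

oddPartitionParity³ : ∀ N →
  oddPartitionParity N ⊗ (oddPartitionParity N ⊗ oddPartitionParity N) ≈[ N ] θ (suc N)
oddPartitionParity³ N = begin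
  P ⊗ (P ⊗ P)                          ≈⟨ ≈⇒≈[] N (≈-sym (⊗-identityˡ (P ⊗ (P ⊗ P)))) ⟩
  1ₛ ⊗ (P ⊗ (P ⊗ P))                   ≈⟨ ≈⇒≈[] N (⊗-congʳ (P ⊗ (P ⊗ P)) (≈-sym (prod-⊗-oddPartitionParity N))) ⟩
  (O ⊗ P) ⊗ (P ⊗ (P ⊗ P))              ≈⟨ ≈⇒≈[] N (solve 2 (λ o p → (o :* p) :* (p :* (p :* p)) := o :* ((p :* p) :* (p :* p)))
                                                          ≈-refl O P) ⟩
  O ⊗ P ² ²                            ≈⟨ ⊗-cong[] (≈[]-sym (jacobi-mod2 N)) ≈[]-refl ⟩
  θ (suc N) ⊗ O ² ² ⊗ P ² ²            ≈⟨ ≈⇒≈[] N (solve 3 (λ t o p → t :* ((o :* o) :* (o :* o)) :* ((p :* p) :* (p :* p))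
                                                                := t :* (((o :* p) :* (o :* p)) :* ((o :* p) :* (o :* p))))
                                                          ≈-refl (θ (suc N)) O P) ⟩
  θ (suc N) ⊗ (O ⊗ P) ² ²              ≈⟨ ≈⇒≈[] N (⊗-congˡ (θ (suc N)) (²-cong (²-cong (prod-⊗-oddPartitionParity N)))) ⟩
  θ (suc N) ⊗ 1ₛ ² ²                   ≈⟨ ≈⇒≈[] N (⊗-congˡ (θ (suc N)) (≈-trans (²-cong (⊗-identityˡ 1ₛ)) (⊗-identityˡ 1ₛ))) ⟩
  θ (suc N) ⊗ 1ₛ                       ≈⟨ ≈⇒≈[] N (⊗-identityʳ (θ (suc N))) ⟩
  θ (suc N)                            ∎
  where
  open ≈[]-Reasoning N
  O P : Series
  O = prod 2 1 N
  P = oddPartitionParity N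

paritySeries-regularTriples-≈[] : ∀ N → paritySeries regularTriples ≈[ N ] θ (suc N)
paritySeries-regularTriples-≈[] N =
  ≈[]-trans (≈⇒≈[] N paritySeries-regularTriples)
  (≈[]-trans (⊗-cong[] e≈P (⊗-cong[] e≈P e≈P)) (oddPartitionParity³ N))
  where e≈P = paritySeries-regularPartitions N

θ-coeff-nontriangular : ∀ {K n} → (∀ m → m < K → triangular m ≢ n) → θ K n ≡ 0ℙ
θ-coeff-nontriangular {zero} _ = refl
θ-coeff-nontriangular {suc K} {n} none =
  trans (∑-suc K (λ m → q^ triangular m) n)
        (cong₂ ℙ._+_ (θ-coeff-nontriangular (λ m m<K → none m (ℕₚ.m≤n⇒m≤1+n m<K)))
                     (q^-coeff-≢ (none K ℕₚ.≤-refl)))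

triangular-strictMono : ∀ {m m′} → m < m′ → triangular m < triangular m′
triangular-strictMono {m} {suc m′} (s≤s m≤m′) with ℕₚ.m≤n⇒m<n∨m≡n m≤m′
... | inj₂ refl = ℕₚ.m<m+n (triangular m) (s≤s z≤n)
... | inj₁ m<m′ = ℕₚ.<-≤-trans (triangular-strictMono m<m′) (ℕₚ.m≤m+n (triangular m′) (suc m′))

θ-coeff-triangular : ∀ {K m} → m < K → θ K (triangular m) ≡ 1ℙ
θ-coeff-triangular {suc K} {m} (s≤s m≤K) with ℕₚ.m≤n⇒m<n∨m≡n m≤K
... | inj₁ m<K = trans (∑-suc K (λ i → q^ triangular i) (triangular m))
                       (cong₂ ℙ._+_ (θ-coeff-triangular m<K)
                                    (q^-coeff-≢ (ℕₚ.>⇒≢ (triangular-strictMono m<K))))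
... | inj₂ refl = trans (∑-suc K (λ i → q^ triangular i) (triangular K))
                        (cong₂ ℙ._+_ (θ-coeff-nontriangular {K} (λ i i<K → ℕₚ.<⇒≢ (triangular-strictMono i<K)))
                                     (q^-coeff-≡ (triangular K)))

2*triangular : ∀ m → 2 * triangular m ≡ m * suc m
2*triangular zero = refl
2*triangular (suc m) = begin
  2 * (triangular m + suc m)       ≡⟨ ℕₚ.*-distribˡ-+ 2 (triangular m) (suc m) ⟩
  2 * triangular m + 2 * suc m     ≡⟨ cong (_+ 2 * suc m) (2*triangular m) ⟩
  m * suc m + 2 * suc m            ≡⟨ expand m ⟩
  suc m * suc (suc m)              ∎
  where
  open ≡-Reasoning
  expand : ∀ m → m * suc m + 2 * suc m ≡ suc m * suc (suc m)
  expand = solve-∀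

Triangular⇒triangular : ∀ n → Triangular n → ∃ λ m → triangular m ≡ n
Triangular⇒triangular n (m , 2n≡m[m+1]) = m , ℕₚ.*-cancelˡ-≡ (triangular m) n 2 (trans (2*triangular m) (sym 2n≡m[m+1]))

triangular⇒Triangular : ∀ {m} n → triangular m ≡ n → Triangular n
triangular⇒Triangular {m} _ refl = m , 2*triangular m

parity≡1ℙ⇒%2≡1 : ∀ n → parity n ≡ 1ℙ → n % 2 ≡ 1
parity≡1ℙ⇒%2≡1 1 _ = refl
parity≡1ℙ⇒%2≡1 (suc (suc n)) odd = parity≡1ℙ⇒%2≡1 n odd

parity≡0ℙ⇒%2≡0 : ∀ n → parity n ≡ 0ℙ → n % 2 ≡ 0
parity≡0ℙ⇒%2≡0 0 _ = refl
parity≡0ℙ⇒%2≡0 (suc (suc n)) even = parity≡0ℙ⇒%2≡0 n even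

lemma2p10 : (n : ℕ) →
    Σ (List (Vec (List ℕ) 3)) λ L →
      Enumerates 2 3 n L ×
      (Triangular n → length L % 2 ≡ 1) ×
      (¬ Triangular n → length L % 2 ≡ 0)
lemma2p10 n = regularTriples n , regularTriples-enumerates n , odd , even
  where
  coefficient : parity (length (regularTriples n)) ≡ θ (suc n) n
  coefficient = paritySeries-regularTriples-≈[] n n ℕₚ.≤-refl
  odd : Triangular n → length (regularTriples n) % 2 ≡ 1
  odd triangular-n = parity≡1ℙ⇒%2≡1 (length (regularTriples n)) (trans coefficient (subst (λ k → θ (suc n) k ≡ 1ℙ) tri≡n
                                                           (θ-coeff-triangular (s≤s m≤n))))
    where
    m = proj₁ (Triangular⇒triangular n triangular-n)
    tri≡n = proj₂ (Triangular⇒triangular n triangular-n)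
    m≤n = subst (m ≤_) tri≡n (m≤triangular m)
  even : ¬ Triangular n → length (regularTriples n) % 2 ≡ 0
  even ¬triangular-n = parity≡0ℙ⇒%2≡0 (length (regularTriples n))
    (trans coefficient (θ-coeff-nontriangular {suc n} (λ m _ → ¬triangular-n ∘ triangular⇒Triangular {m} n)))
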